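{- Let $d\in\mathbb{N}$. (a) If $P\subset\mathbb{R}^d$ is a lattice polytope of dimension $d$ which is $(d+1)$-convex-normal, then $P$ is integrally closed. (b) If $\Box\subset\mathbb{R}^d$ is a rational $d$-dimensional parallelepiped all of whose edges have lattice length at least $1$, then for every $c\in\mathbb{Q}$ with $c\ge1$, $$c\Box=\bigcup_{v\in\operatorname{vert}(\Box)}\ \bigcup_{x\in (c-1)\Box\cap\left((c-1)v+\mathbb{Z}^d\right)} (x+\Box).$$ (c) For every rational $d$-dimensional polytope $P\subset\mathbb{R}^d$ and every $c\in\left[1,\frac{d+1}{d}\right]$, $$cP=\bigcup_{v\in\operatorname{vert}(P)}\ \bigcup_{x\in (c-1)P\cap\left((c-1)v+\mathbb{Z}^d\right)} (x+P).$$
   Context: A polytope is rational (resp. lattice) if its vertices lie in $\mathbb{Q}^d$ (resp. $\mathbb{Z}^d$). The lattice length of a rational segment $[x,y]$ is the ratio of its Euclidean length to that of the primitive integer vector in the direction of $y-x$. A parallelepiped is a Minkowski sum of segments of linearly independent directions. For $k\in\mathbb{Q}_{\ge2}$, a rational $d$-polytope $P\subset\mathbb{R}^d$ is $k$-convex-normal if $cP=\bigcup_{v\in\operatorname{vert}(P)}\bigcup_{x\in (c-1)P\cap((c-1)v+\mathbb{Z}^d)}(x+P)$ for every rational $c\in[2,k]$. A lattice polytope $P\subset\mathbb{R}^d$ is integrally closed if for every $c\in\mathbb{N}$ and every $z\in cP\cap\mathbb{Z}^d$ there exist $x_1,\dots,x_c\in P\cap\mathbb{Z}^d$ with $x_1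+\cdots+x_c=z$.
   Formalization: The set identities in (b) and (c) are asserted for points of ℚ^d instead of ℝ^d, and the scalar c in (c) ranges over the rationals. -}

module Defs where

open import Data.Nat as ℕ using (ℕ; zero; suc)
open import Data.Nat.Divisibility as ℕD using ()
open import Data.Integer as ℤ using (ℤ; +_)
open import Data.Rational using (ℚ; _+_; _*_; _-_; _≤_; _<_; 0ℚ; 1ℚ; _/_)
open import Data.Fin using (Fin; zero; suc)
open import Data.Product using (Σ; ∃; _×_; _,_)
open import Relation.Binary.PropositionalEquality using (_≡_)

-- Points of ℚ^d (rational points of ℝ^d) and subsets of ℚ^d.
Point : ℕ → Set
Point d = Fin d → ℚ

PSet : ℕ → Set₁
PSet d = Point d → Set

ℤtoℚ : ℤ → ℚ
ℤtoℚ z = z / 1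

ℕtoℚ : ℕ → ℚ
ℕtoℚ n = (+ n) / 1

sumℚ : ∀ {n} → (Fin n → ℚ) → ℚ
sumℚ {zero}  f = 0ℚ
sumℚ {suc n} f = f zero + sumℚ (λ i → f (suc i))

sumℤ : ∀ {n} → (Fin n → ℤ) → ℤ
sumℤ {zero}  f = + 0
sumℤ {suc n} f = f zero ℤ.+ sumℤ (λ i → f (suc i))

_≋_ : ∀ {d} → Point d → Point d → Set
x ≋ y = ∀ k → x k ≡ y k

_⊕_ : ∀ {d} → Point d → Point d → Point d
(x ⊕ y) k = x k + y k

_⊖_ : ∀ {d} → Point d → Point d → Point d
(x ⊖ y) k = x k - y k

_·_ : ∀ {d} → ℚ → Point d → Point d
(c · x) k = c * x k

embed : ∀ {d} → (Fin d → ℤ) → Point d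
embed z k = ℤtoℚ (z k)

IsIntegral : ∀ {d} → Point d → Set
IsIntegral x = ∀ k → ∃ λ (z : ℤ) → x k ≡ ℤtoℚ z

_·ₛ_ : ∀ {d} → ℚ → PSet d → PSet d
(c ·ₛ P) y = ∃ λ p → P p × (y ≋ (c · p))

-- convex hull of finitely many rational points (a rational polytope)
Conv : ∀ {d n} → (Fin n → Point d) → PSet d
Conv {d} {n} V y =
  ∃ λ (λs : Fin n → ℚ) → (∀ i → 0ℚ ≤ λs i) × (sumℚ λs ≡ 1ℚ)
    × (∀ k → sumℚ (λ i → λs i * V i k) ≡ y k)

IsVertex : ∀ {d} → PSet d → Point d → Set
IsVertex P v = P v × (∀ y z (t : ℚ) → P y → P z → 0ℚ < t → t < 1ℚ
                 → v ≋ ((t · y) ⊕ ((1ℚ - t) · z)) → y ≋ z)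

AffIndep : ∀ {d m} → (Fin m → Point d) → Set
AffIndep {d} {m} p = ∀ (λs : Fin m → ℚ) → sumℚ λs ≡ 0ℚ
  → (∀ k → sumℚ (λ j → λs j * p j k) ≡ 0ℚ) → ∀ j → λs j ≡ 0ℚ

FullDim : ∀ {d} → PSet d → Set
FullDim {d} P = ∃ λ (p : Fin (suc d) → Point d) → (∀ j → P (p j)) × AffIndep p

LinIndep : ∀ {d m} → (Fin m → Point d) → Set
LinIndep {d} {m} u = ∀ (λs : Fin m → ℚ)
  → (∀ k → sumℚ (λ i → λs i * u i k) ≡ 0ℚ) → ∀ i → λs i ≡ 0ℚ

IsLattice : ∀ {d} → PSet d → Set
IsLattice P = ∀ v → IsVertex P v → IsIntegral v

-- the right-hand side  ⋃_{v ∈ vert P} ⋃_{x ∈ (c-1)P ∩ ((c-1)v + ℤ^d)} (x + P)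
UnionSet : ∀ {d} → PSet d → ℚ → PSet d
UnionSet P c y = ∃ λ v → IsVertex P v × ∃ λ x → ((c - 1ℚ) ·ₛ P) x
  × IsIntegral (x ⊖ ((c - 1ℚ) · v)) × P (y ⊖ x)

DecompEq : ∀ {d} → PSet d → ℚ → Set
DecompEq P c = ∀ y → ((c ·ₛ P) y → UnionSet P c y) × (UnionSet P c y → (c ·ₛ P) y)

ConvexNormal : ∀ {d} → ℚ → PSet d → Set
ConvexNormal k P = ∀ (c : ℚ) → ℕtoℚ 2 ≤ c → c ≤ k → DecompEq P c

IntegrallyClosed : ∀ {d} → PSet d → Set
IntegrallyClosed {d} P = ∀ (c : ℕ) (z : Fin d → ℤ) → ((ℕtoℚ c) ·ₛ P) (embed z)
  → ∃ λ (xs : Fin c → Fin d → ℤ) → (∀ j → P (embed (xs j)))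
      × (∀ k → sumℤ (λ j → xs j k) ≡ z k)

Primitive : ∀ {d} → (Fin d → ℤ) → Set
Primitive w = ∀ (n : ℕ) → (∀ k → n ℕD.∣ ℤ.∣ w k ∣) → n ≡ 1

LatticeLength : ∀ {d} → Point d → ℚ → Set
LatticeLength u ℓ = 0ℚ < ℓ × ∃ λ w → Primitive w × (u ≋ (ℓ · embed w))

-- Minkowski sum of the segments [a i, b i]
SegSum : ∀ {d m} → (Fin m → Point d) → (Fin m → Point d) → PSet d
SegSum {d} {m} a b y = ∃ λ (t : Fin m → ℚ) → (∀ i → 0ℚ ≤ t i × t i ≤ 1ℚ)
  × (∀ k → sumℚ (λ i → a i k + t i * (b i k - a i k)) ≡ y k)

LatLen≥1 : ∀ {d} → Point d → Set
LatLen≥1 u = ∃ λ ℓ → LatticeLength u ℓ × 1ℚ ≤ ℓ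

-- By Carathéodory's theorem a point q of a rational polytope P is a convex combination of at most d + 1
-- vertices, so some vertex v carries weight at least 1/(d+1); then c q − (c − 1) v stays in P whenever
-- c ≤ (d+1)/d, which is (c). For a lattice polytope and c > d + 1 the same vertex splits a lattice point of cP
-- as v plus a lattice point of (c − 1)P; for 2 ≤ c ≤ d + 1 convex normality provides such a splitting, so (a)
-- follows by induction on c. For (b), a point Σᵢ (aᵢ + c tᵢ uᵢ) of c□ is split coordinatewise as
-- c tᵢ = (c − 1) ρᵢ + σᵢ with ρᵢ, σᵢ ∈ [0,1], where ρᵢ is 0, 1 or ⌊c tᵢ ℓᵢ⌋/((c − 1) ℓᵢ), so that
-- (c − 1)(ρᵢ − εᵢ) uᵢ is a lattice vector for a corner ε ∈ {0,1}ᵐ; this uses uᵢ = ℓᵢ wᵢ with wᵢ integral and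
-- ℓᵢ ≥ 1. The reverse inclusions hold for every convex set. Vertices are found constructively: a generating
-- subset none of whose points lies in the hull of the others, found by deciding membership through Gaussian
-- elimination over ℚ, consists of vertices.

module Submission where

open import Defs
open import Data.Bool using (Bool; true; false; if_then_else_; _∧_; not)
open import Data.Bool.Properties using (∧-identityʳ; ¬-not) renaming (_≟_ to _≟ᵇ_)
open import Data.Empty using (⊥-elim)
open import Data.Fin using (Fin; zero; suc)
open import Data.Fin.Properties using (any?; all?) renaming (_≟_ to _≟ᶠ_)
open import Data.Integer as ℤ using (ℤ)
import Data.Integer.DivMod as ℤ
import Data.Integer.Properties as ℤ
open import Data.Nat as ℕ using (ℕ; suc)
import Data.Nat.Properties as ℕ
open import Data.Product using (Σ; ∃; _×_; _,_; proj₁; proj₂)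
open import Data.Rational
open import Data.Rational.Properties
import Data.Rational.Unnormalised as ℚᵘ
import Data.Rational.Unnormalised.Properties as ℚᵘ
open import Data.Rational.Solver using (module +-*-Solver)
open import Data.Sum using (_⊎_; inj₁; inj₂)
open import Data.Unit using (⊤; tt)
open import Data.Vec.Functional using (_∷_)
open import Relation.Binary.PropositionalEquality
open import Relation.Nullary using (Dec; yes; no; does; ¬_)
open import Relation.Nullary.Decidable using (_×-dec_; ¬?; dec-true)

open +-*-Solver

private
  variable
    m n : ℕ
    p q : ℚ

private
  toℚᵘ-ℤtoℚ : ∀ a → toℚᵘ (ℤtoℚ a) ℚᵘ.≃ ℚᵘ.mkℚᵘ a 0
  toℚᵘ-ℤtoℚ a = toℚᵘ-fromℚᵘ (ℚᵘ.mkℚᵘ a 0)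

ℤtoℚ-homo-+ : ∀ a b → ℤtoℚ (a ℤ.+ b) ≡ ℤtoℚ a + ℤtoℚ b
ℤtoℚ-homo-+ a b = toℚᵘ-injective (begin
    toℚᵘ (ℤtoℚ (a ℤ.+ b))           ≈⟨ toℚᵘ-ℤtoℚ (a ℤ.+ b) ⟩
    ℚᵘ.mkℚᵘ (a ℤ.+ b) 0             ≈⟨ ℚᵘ.*≡* (cong (ℤ._* ℤ.+ 1) (sym (cong₂ ℤ._+_ (ℤ.*-identityʳ a) (ℤ.*-identityʳ b)))) ⟩
    ℚᵘ.mkℚᵘ a 0 ℚᵘ.+ ℚᵘ.mkℚᵘ b 0    ≈⟨ ℚᵘ.+-cong (ℚᵘ.≃-sym (toℚᵘ-ℤtoℚ a)) (ℚᵘ.≃-sym (toℚᵘ-ℤtoℚ b)) ⟩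
    toℚᵘ (ℤtoℚ a) ℚᵘ.+ toℚᵘ (ℤtoℚ b) ≈⟨ ℚᵘ.≃-sym (toℚᵘ-homo-+ (ℤtoℚ a) (ℤtoℚ b)) ⟩
    toℚᵘ (ℤtoℚ a + ℤtoℚ b)           ∎)
  where open ℚᵘ.≃-Reasoning

ℤtoℚ-homo-* : ∀ a b → ℤtoℚ (a ℤ.* b) ≡ ℤtoℚ a * ℤtoℚ b
ℤtoℚ-homo-* a b = toℚᵘ-injective (begin
    toℚᵘ (ℤtoℚ (a ℤ.* b))           ≈⟨ toℚᵘ-ℤtoℚ (a ℤ.* b) ⟩
    ℚᵘ.mkℚᵘ (a ℤ.* b) 0             ≈⟨ ℚᵘ.*≡* refl ⟩
    ℚᵘ.mkℚᵘ a 0 ℚᵘ.* ℚᵘ.mkℚᵘ b 0    ≈⟨ ℚᵘ.*-cong (ℚᵘ.≃-sym (toℚᵘ-ℤtoℚ a)) (ℚᵘ.≃-sym (toℚᵘ-ℤtoℚ b)) ⟩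
    toℚᵘ (ℤtoℚ a) ℚᵘ.* toℚᵘ (ℤtoℚ b) ≈⟨ ℚᵘ.≃-sym (toℚᵘ-homo-* (ℤtoℚ a) (ℤtoℚ b)) ⟩
    toℚᵘ (ℤtoℚ a * ℤtoℚ b)           ∎)
  where open ℚᵘ.≃-Reasoning

ℤtoℚ-homo-- : ∀ a b → ℤtoℚ (a ℤ.- b) ≡ ℤtoℚ a - ℤtoℚ b
ℤtoℚ-homo-- a b = trans (ℤtoℚ-homo-+ a (ℤ.- b)) (cong (ℤtoℚ a +_) ℤtoℚ-neg)
  where
    ℤtoℚ-neg : ℤtoℚ (ℤ.- b) ≡ - ℤtoℚ b
    ℤtoℚ-neg = begin
      ℤtoℚ (ℤ.- b)                      ≡⟨ solve 2 (λ x y → x := (x :+ y) :- y) refl (ℤtoℚ (ℤ.- b)) (ℤtoℚ b) ⟩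
      (ℤtoℚ (ℤ.- b) + ℤtoℚ b) - ℤtoℚ b ≡⟨ cong (_- ℤtoℚ b) (sym (ℤtoℚ-homo-+ (ℤ.- b) b)) ⟩
      ℤtoℚ (ℤ.- b ℤ.+ b) - ℤtoℚ b      ≡⟨ cong (λ z → ℤtoℚ z - ℤtoℚ b) (ℤ.+-inverseˡ b) ⟩
      0ℚ - ℤtoℚ b                       ≡⟨ +-identityˡ (- ℤtoℚ b) ⟩
      - ℤtoℚ b                          ∎
      where open ≡-Reasoning

ℤtoℚ-homo-sumℤ : ∀ {m} (f : Fin m → ℤ) → ℤtoℚ (sumℤ f) ≡ sumℚ (λ i → ℤtoℚ (f i))
ℤtoℚ-homo-sumℤ {ℕ.zero} f = refl
ℤtoℚ-homo-sumℤ {suc m}  f =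
  trans (ℤtoℚ-homo-+ (f zero) _) (cong (ℤtoℚ (f zero) +_) (ℤtoℚ-homo-sumℤ (λ i → f (suc i))))

ℤtoℚ-injective : ∀ {a b} → ℤtoℚ a ≡ ℤtoℚ b → a ≡ b
ℤtoℚ-injective {a} {b} eq
  with ℚᵘ.*≡* a*1≡b*1 ← ℚᵘ.≃-trans (ℚᵘ.≃-sym (toℚᵘ-ℤtoℚ a)) (ℚᵘ.≃-trans (toℚᵘ-cong eq) (toℚᵘ-ℤtoℚ b))
  = trans (sym (ℤ.*-identityʳ a)) (trans a*1≡b*1 (ℤ.*-identityʳ b))

ℤtoℚ-mono-≤ : ∀ {a b} → a ℤ.≤ b → ℤtoℚ a ≤ ℤtoℚ b
ℤtoℚ-mono-≤ {a} {b} a≤b = toℚᵘ-cancel-≤ (begin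
    toℚᵘ (ℤtoℚ a) ≃⟨ toℚᵘ-ℤtoℚ a ⟩
    ℚᵘ.mkℚᵘ a 0   ≤⟨ ℚᵘ.*≤* (subst₂ ℤ._≤_ (sym (ℤ.*-identityʳ a)) (sym (ℤ.*-identityʳ b)) a≤b) ⟩
    ℚᵘ.mkℚᵘ b 0   ≃⟨ ℚᵘ.≃-sym (toℚᵘ-ℤtoℚ b) ⟩
    toℚᵘ (ℤtoℚ b) ∎)
  where open ℚᵘ.≤-Reasoning

ℕtoℚ-suc : ∀ m → ℕtoℚ (suc m) ≡ 1ℚ + ℕtoℚ m
ℕtoℚ-suc m = ℤtoℚ-homo-+ (ℤ.+ 1) (ℤ.+ m)

ℕtoℚ-mono-≤ : ∀ {m n} → m ℕ.≤ n → ℕtoℚ m ≤ ℕtoℚ n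
ℕtoℚ-mono-≤ m≤n = ℤtoℚ-mono-≤ (ℤ.+≤+ m≤n)

0≤ℕtoℚ : ∀ m → 0ℚ ≤ ℕtoℚ m
0≤ℕtoℚ m = ℕtoℚ-mono-≤ {0} {m} ℕ.z≤n

0<1 : 0ℚ < 1ℚ
0<1 = *<* (ℤ.+<+ (ℕ.s≤s ℕ.z≤n))

0<ℕtoℚ-suc : ∀ m → 0ℚ < ℕtoℚ (suc m)
0<ℕtoℚ-suc m = <-≤-trans 0<1 (ℕtoℚ-mono-≤ {1} {suc m} (ℕ.s≤s ℕ.z≤n))

-- A total inverse, junk value 0⁻¹ = 0, which spares threading NonZero instances around.
inv : ℚ → ℚ
inv p with p ≟ 0ℚ
... | yes _   = 0ℚ
... | no p≢0 = 1/_ p {{≢-nonZero p≢0}}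

*-inv : p ≢ 0ℚ → p * inv p ≡ 1ℚ
*-inv {p} p≢0 with p ≟ 0ℚ
... | yes p≡0 = ⊥-elim (p≢0 p≡0)
... | no p≢0′ = *-inverseʳ p {{≢-nonZero p≢0′}}

pos⇒≢0 : 0ℚ < p → p ≢ 0ℚ
pos⇒≢0 0<p = ≢-sym (<⇒≢ 0<p)

*-monoˡ-≤-0≤ : ∀ {r} → 0ℚ ≤ r → p ≤ q → r * p ≤ r * q
*-monoˡ-≤-0≤ {r = r} 0≤r = *-monoˡ-≤-nonNeg r {{nonNegative 0≤r}}

*-monoʳ-≤-0≤ : ∀ {r} → 0ℚ ≤ r → p ≤ q → p * r ≤ q * r
*-monoʳ-≤-0≤ {r = r} 0≤r = *-monoʳ-≤-nonNeg r {{nonNegative 0≤r}}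

*-cancelʳ-≤-0< : ∀ {r} → 0ℚ < r → p * r ≤ q * r → p ≤ q
*-cancelʳ-≤-0< {r = r} 0<r = *-cancelʳ-≤-pos r {{positive 0<r}}

0≤* : 0ℚ ≤ p → 0ℚ ≤ q → 0ℚ ≤ p * q
0≤* {p} 0≤p 0≤q = ≤-trans (≤-reflexive (sym (*-zeroʳ p))) (*-monoˡ-≤-0≤ 0≤p 0≤q)

0<inv : 0ℚ < p → 0ℚ < inv p
0<inv {p} 0<p with 0ℚ <? inv p
... | yes 0<p⁻¹ = 0<p⁻¹
... | no  0≮p⁻¹ = ⊥-elim (<-irrefl refl (<-≤-trans 0<1 (begin
    1ℚ          ≡⟨ sym (*-inv (pos⇒≢0 0<p)) ⟩
    p * inv p   ≤⟨ *-monoˡ-≤-0≤ (<⇒≤ 0<p) (≮⇒≥ 0≮p⁻¹) ⟩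
    p * 0ℚ      ≡⟨ *-zeroʳ p ⟩
    0ℚ          ∎)))
  where open ≤-Reasoning

0≤inv : 0ℚ < p → 0ℚ ≤ inv p
0≤inv 0<p = <⇒≤ (0<inv 0<p)

0≤q-p : p ≤ q → 0ℚ ≤ q - p
0≤q-p {p} p≤q = ≤-trans (≤-reflexive (sym (+-inverseʳ p))) (+-monoˡ-≤ (- p) p≤q)

0<q-p : p < q → 0ℚ < q - p
0<q-p {p} p<q = ≤-<-trans (≤-reflexive (sym (+-inverseʳ p))) (+-monoˡ-< (- p) p<q)

≤-by-difference : ∀ r → 0ℚ ≤ r → q - p ≡ r → p ≤ q
≤-by-difference {q} {p} r 0≤r q-p≡r = begin
  p             ≡⟨ sym (+-identityʳ p) ⟩
  p + 0ℚ        ≤⟨ +-monoʳ-≤ p 0≤r ⟩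
  p + r         ≡⟨ cong (p +_) (sym q-p≡r) ⟩
  p + (q - p)   ≡⟨ solve 2 (λ p q → p :+ (q :- p) := q) refl p q ⟩
  q             ∎
  where open ≤-Reasoning

neg-involutive : ∀ p → - - p ≡ p
neg-involutive p = solve 1 (λ p → :- :- p := p) refl p

≤∧≢⇒< : p ≤ q → p ≢ q → p < q
≤∧≢⇒< {p} {q} p≤q p≢q with p <? q
... | yes p<q = p<q
... | no  p≮q = ⊥-elim (p≢q (≤-antisym p≤q (≮⇒≥ p≮q)))

0≤∧0≤∧+≡0⇒≡0 : 0ℚ ≤ p → 0ℚ ≤ q → p + q ≡ 0ℚ → p ≡ 0ℚ
0≤∧0≤∧+≡0⇒≡0 {p} 0≤p 0≤q p+q≡0 =
  ≤-antisym (≤-trans (≤-trans (≤-reflexive (sym (+-identityʳ p))) (+-monoʳ-≤ p 0≤q)) (≤-reflexive p+q≡0)) 0≤p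

*-cancelˡ-≡0 : p ≢ 0ℚ → p * q ≡ 0ℚ → q ≡ 0ℚ
*-cancelˡ-≡0 {p} {q} p≢0 pq≡0 = begin
  q                 ≡⟨ sym (*-identityˡ q) ⟩
  1ℚ * q            ≡⟨ cong (_* q) (sym (*-inv p≢0)) ⟩
  (p * inv p) * q   ≡⟨ solve 3 (λ p i q → (p :* i) :* q := i :* (p :* q)) refl p (inv p) q ⟩
  inv p * (p * q)   ≡⟨ cong (inv p *_) pq≡0 ⟩
  inv p * 0ℚ        ≡⟨ *-zeroʳ (inv p) ⟩
  0ℚ                ∎
  where open ≡-Reasoning

convex-combination≡0 : ∀ {t a b} → 0ℚ < t → t < 1ℚ → 0ℚ ≤ a → 0ℚ ≤ b
  → t * a + (1ℚ - t) * b ≡ 0ℚ → a ≡ 0ℚ × b ≡ 0ℚ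
convex-combination≡0 {t} {a} {b} 0<t t<1 0≤a 0≤b sum≡0 =
    *-cancelˡ-≡0 (pos⇒≢0 0<t) (0≤∧0≤∧+≡0⇒≡0 0≤ta 0≤sb sum≡0)
  , *-cancelˡ-≡0 (pos⇒≢0 (0<q-p t<1)) (0≤∧0≤∧+≡0⇒≡0 0≤sb 0≤ta (trans (+-comm ((1ℚ - t) * b) (t * a)) sum≡0))
  where
    0≤ta = 0≤* (<⇒≤ 0<t) 0≤a
    0≤sb = 0≤* (<⇒≤ (0<q-p t<1)) 0≤b

convex-combination≡1 : ∀ {t a b} → 0ℚ < t → t < 1ℚ → a ≤ 1ℚ → b ≤ 1ℚ
  → t * a + (1ℚ - t) * b ≡ 1ℚ → a ≡ 1ℚ × b ≡ 1ℚ
convex-combination≡1 {t} {a} {b} 0<t t<1 a≤1 b≤1 sum≡1 =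
  let 1-a≡0 , 1-b≡0 = convex-combination≡0 0<t t<1 (0≤q-p a≤1) (0≤q-p b≤1) complement≡0
  in  1-x≡0⇒x≡1 1-a≡0 , 1-x≡0⇒x≡1 1-b≡0
  where
    complement≡0 : t * (1ℚ - a) + (1ℚ - t) * (1ℚ - b) ≡ 0ℚ
    complement≡0 = trans (solve 3 (λ t a b → t :* (con 1ℚ :- a) :+ (con 1ℚ :- t) :* (con 1ℚ :- b)
                                          := con 1ℚ :- (t :* a :+ (con 1ℚ :- t) :* b)) refl t a b)
                         (trans (cong (λ z → 1ℚ - z) sum≡1) (+-inverseʳ 1ℚ))
    1-x≡0⇒x≡1 : ∀ {x} → 1ℚ - x ≡ 0ℚ → x ≡ 1ℚ
    1-x≡0⇒x≡1 {x} 1-x≡0 = trans (solve 1 (λ x → x := con 1ℚ :- (con 1ℚ :- x)) refl x)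
                                (trans (cong (λ z → 1ℚ - z) 1-x≡0) (+-identityʳ 1ℚ))

x*↧x≡↥x : ∀ x → x * ℤtoℚ (↧ x) ≡ ℤtoℚ (↥ x)
x*↧x≡↥x x@(mkℚ num den-1 _) = toℚᵘ-injective (begin
    toℚᵘ (x * ℤtoℚ den)                    ≈⟨ toℚᵘ-homo-* x (ℤtoℚ den) ⟩
    ℚᵘ.mkℚᵘ num den-1 ℚᵘ.* toℚᵘ (ℤtoℚ den) ≈⟨ ℚᵘ.*-congˡ {ℚᵘ.mkℚᵘ num den-1} (toℚᵘ-ℤtoℚ den) ⟩
    ℚᵘ.mkℚᵘ num den-1 ℚᵘ.* ℚᵘ.mkℚᵘ den 0   ≈⟨ ℚᵘ.*≡* (trans (ℤ.*-identityʳ _)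
                                                (cong (λ t → num ℤ.* ℤ.+ t) (sym (ℕ.*-identityʳ (suc den-1))))) ⟩
    ℚᵘ.mkℚᵘ num 0                          ≈⟨ ℚᵘ.≃-sym (toℚᵘ-ℤtoℚ num) ⟩
    toℚᵘ (ℤtoℚ num)                        ∎)
  where
    open ℚᵘ.≃-Reasoning
    den = ℤ.+ suc den-1

floor-bounds : ∀ x → ℤtoℚ (floor x) ≤ x × x ≤ ℤtoℚ (floor x) + 1ℚ
floor-bounds x@(mkℚ num den-1 _) = lower , upper
  where
    den = ℤ.+ suc den-1
    ⌊x⌋ = floor x
    ρ = num ℤ.% den
    num≡ρ+⌊x⌋*den : num ≡ ℤ.+ ρ ℤ.+ ⌊x⌋ ℤ.* den
    num≡ρ+⌊x⌋*den = ℤ.a≡a%n+[a/n]*n num den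
    0<den : 0ℚ < ℤtoℚ den
    0<den = 0<ℕtoℚ-suc den-1
    lower : ℤtoℚ ⌊x⌋ ≤ x
    lower = *-cancelʳ-≤-0< 0<den (begin
        ℤtoℚ ⌊x⌋ * ℤtoℚ den       ≡⟨ sym (ℤtoℚ-homo-* ⌊x⌋ den) ⟩
        ℤtoℚ (⌊x⌋ ℤ.* den)         ≤⟨ ℤtoℚ-mono-≤ (ℤ.i≤j+i (⌊x⌋ ℤ.* den) (ℤ.+ ρ)) ⟩
        ℤtoℚ (ℤ.+ ρ ℤ.+ ⌊x⌋ ℤ.* den) ≡⟨ cong ℤtoℚ (sym num≡ρ+⌊x⌋*den) ⟩
        ℤtoℚ num                   ≡⟨ sym (x*↧x≡↥x x) ⟩
        x * ℤtoℚ den               ∎)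
      where open ≤-Reasoning
    upper : x ≤ ℤtoℚ ⌊x⌋ + 1ℚ
    upper = *-cancelʳ-≤-0< 0<den (begin
        x * ℤtoℚ den                 ≡⟨ x*↧x≡↥x x ⟩
        ℤtoℚ num                     ≡⟨ cong ℤtoℚ num≡ρ+⌊x⌋*den ⟩
        ℤtoℚ (ℤ.+ ρ ℤ.+ ⌊x⌋ ℤ.* den) ≤⟨ ℤtoℚ-mono-≤ (ℤ.+-monoˡ-≤ (⌊x⌋ ℤ.* den) (ℤ.+≤+ (ℕ.<⇒≤ (ℤ.n%d<d num den)))) ⟩
        ℤtoℚ (den ℤ.+ ⌊x⌋ ℤ.* den)   ≡⟨ trans (ℤtoℚ-homo-+ den (⌊x⌋ ℤ.* den)) (cong (ℤtoℚ den +_) (ℤtoℚ-homo-* ⌊x⌋ den)) ⟩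
        ℤtoℚ den + ℤtoℚ ⌊x⌋ * ℤtoℚ den ≡⟨ solve 2 (λ d q → d :+ q :* d := (q :+ con 1ℚ) :* d) refl (ℤtoℚ den) (ℤtoℚ ⌊x⌋) ⟩
        (ℤtoℚ ⌊x⌋ + 1ℚ) * ℤtoℚ den   ∎)
      where open ≤-Reasoning

sumℚ-cong : {f g : Fin n → ℚ} → (∀ i → f i ≡ g i) → sumℚ f ≡ sumℚ g
sumℚ-cong {ℕ.zero} f≗g = refl
sumℚ-cong {suc n}  f≗g = cong₂ _+_ (f≗g zero) (sumℚ-cong (λ i → f≗g (suc i)))

sumℚ-+ : (f g : Fin n → ℚ) → sumℚ (λ i → f i + g i) ≡ sumℚ f + sumℚ g
sumℚ-+ {ℕ.zero} f g = refl
sumℚ-+ {suc n}  f g = trans (cong ((f zero + g zero) +_) (sumℚ-+ (λ i → f (suc i)) (λ i → g (suc i))))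
  (solve 4 (λ a b c d → (a :+ b) :+ (c :+ d) := (a :+ c) :+ (b :+ d)) refl
     (f zero) (g zero) (sumℚ (λ i → f (suc i))) (sumℚ (λ i → g (suc i))))

sumℚ-*ˡ : ∀ c (f : Fin n → ℚ) → sumℚ (λ i → c * f i) ≡ c * sumℚ f
sumℚ-*ˡ {ℕ.zero} c f = sym (*-zeroʳ c)
sumℚ-*ˡ {suc n}  c f = trans (cong ((c * f zero) +_) (sumℚ-*ˡ c (λ i → f (suc i))))
  (sym (*-distribˡ-+ c (f zero) _))

sumℚ-*ʳ : ∀ c (f : Fin n → ℚ) → sumℚ (λ i → f i * c) ≡ sumℚ f * c
sumℚ-*ʳ c f = trans (sumℚ-cong (λ i → *-comm (f i) c)) (trans (sumℚ-*ˡ c f) (*-comm c (sumℚ f)))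

sumℚ-0 : sumℚ {n} (λ _ → 0ℚ) ≡ 0ℚ
sumℚ-0 {ℕ.zero} = refl
sumℚ-0 {suc n}  = trans (+-identityˡ _) (sumℚ-0 {n})

sumℚ-neg : (f : Fin n → ℚ) → sumℚ (λ i → - f i) ≡ - sumℚ f
sumℚ-neg {ℕ.zero} f = refl
sumℚ-neg {suc n}  f = trans (cong ((- f zero) +_) (sumℚ-neg (λ i → f (suc i))))
  (sym (neg-distrib-+ (f zero) _))

sumℚ-- : (f g : Fin n → ℚ) → sumℚ (λ i → f i - g i) ≡ sumℚ f - sumℚ g
sumℚ-- f g = trans (sumℚ-+ f (λ i → - g i)) (cong (sumℚ f +_) (sumℚ-neg g))

sumℚ-linear : ∀ a b (f g : Fin n → ℚ) → sumℚ (λ i → a * f i + b * g i) ≡ a * sumℚ f + b * sumℚ g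
sumℚ-linear a b f g = trans (sumℚ-+ (λ i → a * f i) (λ i → b * g i)) (cong₂ _+_ (sumℚ-*ˡ a f) (sumℚ-*ˡ b g))

sumℚ-mono-≤ : {f g : Fin n → ℚ} → (∀ i → f i ≤ g i) → sumℚ f ≤ sumℚ g
sumℚ-mono-≤ {ℕ.zero} f≤g = ≤-refl
sumℚ-mono-≤ {suc n}  f≤g = +-mono-≤ (f≤g zero) (sumℚ-mono-≤ (λ i → f≤g (suc i)))

0≤sumℚ : {f : Fin n → ℚ} → (∀ i → 0ℚ ≤ f i) → 0ℚ ≤ sumℚ f
0≤sumℚ {n} 0≤f = ≤-trans (≤-reflexive (sym (sumℚ-0 {n}))) (sumℚ-mono-≤ 0≤f)

sumℚ-δ : ∀ (j : Fin n) (g : Fin n → ℚ) → sumℚ (λ k → if does (j ≟ᶠ k) then g k else 0ℚ) ≡ g j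
sumℚ-δ {suc n} zero    g = trans (cong (g zero +_) (sumℚ-0 {n})) (+-identityʳ (g zero))
sumℚ-δ         (suc j) g = trans (+-identityˡ _) (sumℚ-δ j (λ k → g (suc k)))

zeroAt : Fin n → (Fin n → ℚ) → Fin n → ℚ
zeroAt j f k = if does (j ≟ᶠ k) then 0ℚ else f k

zeroAt-self : ∀ (j : Fin n) (f : Fin n → ℚ) → zeroAt j f j ≡ 0ℚ
zeroAt-self j f rewrite dec-true (j ≟ᶠ j) refl = refl

zeroAt-≢ : ∀ (j : Fin n) (f : Fin n → ℚ) {k} → j ≢ k → zeroAt j f k ≡ f k
zeroAt-≢ j f {k} j≢k with j ≟ᶠ k
... | yes j≡k = ⊥-elim (j≢k j≡k)
... | no  _   = refl

zeroAt-*ʳ : ∀ (j k : Fin n) (f : Fin n → ℚ) x → zeroAt j f k * x ≡ zeroAt j (λ i → f i * x) k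
zeroAt-*ʳ j k f x with j ≟ᶠ k
... | yes _ = *-zeroˡ x
... | no  _ = refl

*-zeroAtʳ : ∀ (j k : Fin n) (f g : Fin n → ℚ) → f k * zeroAt j g k ≡ zeroAt j (λ i → f i * g i) k
*-zeroAtʳ j k f g with j ≟ᶠ k
... | yes _ = *-zeroʳ (f k)
... | no  _ = refl

0≤zeroAt : ∀ (j : Fin n) {f} → (∀ i → 0ℚ ≤ f i) → ∀ k → 0ℚ ≤ zeroAt j f k
0≤zeroAt j 0≤f k with j ≟ᶠ k
... | yes _ = ≤-refl
... | no  _ = 0≤f k

sumℚ-zeroAt : ∀ (j : Fin n) (f : Fin n → ℚ) → sumℚ f ≡ f j + sumℚ (zeroAt j f)
sumℚ-zeroAt j f = begin
  sumℚ f                                                  ≡⟨ sumℚ-cong split ⟩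
  sumℚ (λ k → (if does (j ≟ᶠ k) then f k else 0ℚ) + zeroAt j f k)
                                                          ≡⟨ sumℚ-+ _ (zeroAt j f) ⟩
  sumℚ (λ k → if does (j ≟ᶠ k) then f k else 0ℚ) + sumℚ (zeroAt j f)
                                                          ≡⟨ cong (_+ sumℚ (zeroAt j f)) (sumℚ-δ j f) ⟩
  f j + sumℚ (zeroAt j f)                                 ∎
  where
    open ≡-Reasoning
    split : ∀ k → f k ≡ (if does (j ≟ᶠ k) then f k else 0ℚ) + zeroAt j f k
    split k with j ≟ᶠ k
    ... | yes _ = sym (+-identityʳ (f k))
    ... | no  _ = sym (+-identityˡ (f k))

sumℚ-without : ∀ (j : Fin n) (f : Fin n → ℚ) → sumℚ (zeroAt j f) ≡ sumℚ f - f j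
sumℚ-without j f = trans (solve 2 (λ a r → r := (a :+ r) :- a) refl (f j) (sumℚ (zeroAt j f)))
                         (cong (_- f j) (sym (sumℚ-zeroAt j f)))

entry≤sumℚ : {f : Fin n → ℚ} → (∀ i → 0ℚ ≤ f i) → ∀ j → f j ≤ sumℚ f
entry≤sumℚ {f = f} 0≤f j = begin
  f j                     ≡⟨ sym (+-identityʳ (f j)) ⟩
  f j + 0ℚ                ≤⟨ +-monoʳ-≤ (f j) (0≤sumℚ (0≤zeroAt j 0≤f)) ⟩
  f j + sumℚ (zeroAt j f) ≡⟨ sym (sumℚ-zeroAt j f) ⟩
  sumℚ f                  ∎
  where open ≤-Reasoning

sumℚ≡0⇒≡0 : {f : Fin n → ℚ} → (∀ i → 0ℚ ≤ f i) → sumℚ f ≡ 0ℚ → ∀ j → f j ≡ 0ℚ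
sumℚ≡0⇒≡0 0≤f sum≡0 j = ≤-antisym (≤-trans (entry≤sumℚ 0≤f j) (≤-reflexive sum≡0)) (0≤f j)

sumℚ-concentrated : ∀ (α : Fin n → ℚ) j → (∀ i → 0ℚ ≤ α i) → sumℚ α ≡ 1ℚ → α j ≡ 1ℚ
  → ∀ (g : Fin n → ℚ) → sumℚ (λ i → α i * g i) ≡ g j
sumℚ-concentrated {n} α j 0≤α sum≡1 αj≡1 g = begin
  sumℚ (λ i → α i * g i)                       ≡⟨ sumℚ-zeroAt j (λ i → α i * g i) ⟩
  α j * g j + sumℚ (zeroAt j (λ i → α i * g i)) ≡⟨ cong₂ _+_ (trans (cong (_* g j) αj≡1) (*-identityˡ (g j)))
                                                     (trans (sumℚ-cong others≡0) (sumℚ-0 {n})) ⟩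
  g j + 0ℚ                                     ≡⟨ +-identityʳ (g j) ⟩
  g j                                          ∎
  where
    open ≡-Reasoning
    rest≡0 : ∀ i → zeroAt j α i ≡ 0ℚ
    rest≡0 = sumℚ≡0⇒≡0 (0≤zeroAt j 0≤α)
      (trans (sumℚ-without j α) (trans (cong₂ _-_ sum≡1 αj≡1) (+-inverseʳ 1ℚ)))
    others≡0 : ∀ i → zeroAt j (λ i → α i * g i) i ≡ 0ℚ
    others≡0 i = trans (sym (zeroAt-*ʳ j i α (g i))) (trans (cong (_* g i) (rest≡0 i)) (*-zeroˡ (g i)))

δ : Fin n → Fin n → ℚ
δ j k = if does (j ≟ᶠ k) then 1ℚ else 0ℚ

0≤δ : ∀ (j k : Fin n) → 0ℚ ≤ δ j k
0≤δ j k with j ≟ᶠ k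
... | yes _ = <⇒≤ 0<1
... | no  _ = ≤-refl

sumℚ-δ-* : ∀ (j : Fin n) (g : Fin n → ℚ) → sumℚ (λ k → δ j k * g k) ≡ g j
sumℚ-δ-* j g = trans (sumℚ-cong pointwise) (sumℚ-δ j g)
  where
    pointwise : ∀ k → δ j k * g k ≡ (if does (j ≟ᶠ k) then g k else 0ℚ)
    pointwise k with j ≟ᶠ k
    ... | yes _ = *-identityˡ (g k)
    ... | no  _ = *-zeroˡ (g k)

dot : (Fin n → ℚ) → (Fin n → ℚ) → ℚ
dot f g = sumℚ (λ k → f k * g k)

dot-+δ : ∀ (f g : Fin n → ℚ) j a → dot f (λ k → g k + a * δ j k) ≡ dot f g + f j * a
dot-+δ f g j a = begin
  dot f (λ k → g k + a * δ j k)                       ≡⟨ sumℚ-cong (λ k → *-distribˡ-+ (f k) (g k) (a * δ j k)) ⟩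
  sumℚ (λ k → f k * g k + f k * (a * δ j k))          ≡⟨ sumℚ-+ (λ k → f k * g k) _ ⟩
  dot f g + sumℚ (λ k → f k * (a * δ j k))            ≡⟨ cong (dot f g +_) (trans (sumℚ-cong reorder) (sumℚ-δ-* j (λ k → f k * a))) ⟩
  dot f g + f j * a                                   ∎
  where
    open ≡-Reasoning
    reorder : ∀ k → f k * (a * δ j k) ≡ δ j k * (f k * a)
    reorder k = solve 3 (λ x a d → x :* (a :* d) := d :* (x :* a)) refl (f k) a (δ j k)

dot-zeroAt : ∀ (f κ : Fin n → ℚ) j → dot f κ ≡ f j * κ j + dot f (zeroAt j κ)
dot-zeroAt f κ j = trans (sumℚ-zeroAt j (λ k → f k * κ k))
  (cong (f j * κ j +_) (sumℚ-cong (λ k → sym (*-zeroAtʳ j k f κ))))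

Indices : ℕ → Set
Indices n = Fin n → Bool

_∖_ : Indices n → Fin n → Indices n
(S ∖ j) k = S k ∧ not (does (j ≟ᶠ k))

size : Indices n → ℕ
size {ℕ.zero} S = 0
size {suc n}  S = (if S zero then 1 else 0) ℕ.+ size (λ k → S (suc k))

SupportedIn : Indices n → (Fin n → ℚ) → Set
SupportedIn S w = ∀ k → S k ≡ false → w k ≡ 0ℚ

size-cong : {S T : Indices n} → (∀ k → S k ≡ T k) → size S ≡ size T
size-cong {ℕ.zero} S≗T = refl
size-cong {suc n}  S≗T = cong₂ ℕ._+_ (cong (λ b → if b then 1 else 0) (S≗T zero)) (size-cong (λ k → S≗T (suc k)))

size-∅ : {S : Indices n} → (∀ k → S k ≡ false) → size S ≡ 0
size-∅ {ℕ.zero} S≡∅ = refl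
size-∅ {suc n}  S≡∅ rewrite S≡∅ zero = size-∅ (λ k → S≡∅ (suc k))

size-∖ : {S : Indices n} (j : Fin n) → S j ≡ true → size S ≡ suc (size (S ∖ j))
size-∖ {suc n} {S} zero    j∈S rewrite j∈S = cong suc (size-cong (λ k → sym (∧-identityʳ (S (suc k)))))
size-∖ {suc n} {S} (suc j) j∈S with S zero
... | true  = cong suc (size-∖ {S = λ k → S (suc k)} j j∈S)
... | false = size-∖ {S = λ k → S (suc k)} j j∈S

size≤ : (S : Indices n) → size S ℕ.≤ n
size≤ {ℕ.zero} S = ℕ.z≤n
size≤ {suc n}  S with S zero
... | true  = ℕ.s≤s (size≤ (λ k → S (suc k)))
... | false = ℕ.m≤n⇒m≤1+n (size≤ (λ k → S (suc k)))

size-∖-≤ : ∀ {f} {S : Indices n} j → S j ≡ true → size S ℕ.≤ suc f → size (S ∖ j) ℕ.≤ f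
size-∖-≤ {S = S} j j∈S size≤1+f = ℕ.≤-pred (subst (ℕ._≤ _) (size-∖ {S = S} j j∈S) size≤1+f)

∈⇒size≢0 : ∀ {S : Indices n} j → S j ≡ true → size S ≢ 0
∈⇒size≢0 {S = S} j j∈S size≡0 with () ← trans (sym (size-∖ {S = S} j j∈S)) size≡0

∖-false : ∀ {S : Indices n} {j k} → (S ∖ j) k ≡ false → S k ≡ false ⊎ j ≡ k
∖-false {S = S} {j} {k} eq with S k | j ≟ᶠ k
... | false | _      = inj₁ refl
... | true  | yes j≡k = inj₂ j≡k
... | true  | no  _   with () ← eq

∖-true : ∀ {S : Indices n} {j k} → (S ∖ j) k ≡ true → S k ≡ true × j ≢ k
∖-true {S = S} {j} {k} eq with S k | j ≟ᶠ k
... | true  | no j≢k = refl , j≢k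
... | true  | yes _  with () ← eq
... | false | _      with () ← eq

SupportedIn-∖ : ∀ {S : Indices n} j {w} → SupportedIn (S ∖ j) w → SupportedIn S w
SupportedIn-∖ j supp k k∉S = supp k (cong (_∧ _) k∉S)

zeroAt-supported : ∀ {S : Indices n} j {w} → SupportedIn S w → SupportedIn (S ∖ j) (zeroAt j w)
zeroAt-supported {S = S} j {w} supp k k∉S∖j with ∖-false {S = S} {j} {k} k∉S∖j
... | inj₂ refl = zeroAt-self j w
... | inj₁ k∉S  with j ≟ᶠ k
...   | yes _ = refl
...   | no  _ = supp k k∉S

∈⇒≢ : ∀ {S : Indices n} {j k} → S j ≡ true → S k ≡ false → j ≢ k
∈⇒≢ j∈S k∉S refl with () ← trans (sym j∈S) k∉S

argmin : (P : Fin n → Set) → (∀ k → Dec (P k)) → (f : Fin n → ℚ) → Σ (Fin n) P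
       → Σ (Fin n) λ j → P j × (∀ k → P k → f j ≤ f k)
argmin {suc n} P P? f (j , Pj) with any? (λ k → P? (suc k))
argmin {suc n} P P? f (zero , P₀)  | no ¬tail = zero , P₀ , λ { zero _ → ≤-refl ; (suc k) Pk → ⊥-elim (¬tail (k , Pk)) }
argmin {suc n} P P? f (suc j , Pj) | no ¬tail = ⊥-elim (¬tail (j , Pj))
... | yes tail with argmin (λ k → P (suc k)) (λ k → P? (suc k)) (λ k → f (suc k)) tail
...   | j′ , Pj′ , min′ with P? zero
...     | no ¬P₀ = suc j′ , Pj′ , λ { zero P₀ → ⊥-elim (¬P₀ P₀) ; (suc k) Pk → min′ k Pk }
...     | yes P₀ with f zero ≤? f (suc j′)
...       | yes f₀≤ = zero , P₀ , λ { zero _ → ≤-refl ; (suc k) Pk → ≤-trans f₀≤ (min′ k Pk) }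
...       | no  f₀≰ = suc j′ , Pj′ , λ { zero _ → <⇒≤ (≰⇒> f₀≰) ; (suc k) Pk → min′ k Pk }

sumℚ-indicator : ∀ (U : Indices n) a → sumℚ (λ i → if U i then a else 0ℚ) ≡ a * ℕtoℚ (size U)
sumℚ-indicator {ℕ.zero} U a = sym (*-zeroʳ a)
sumℚ-indicator {suc n}  U a with U zero
... | true  = begin
  a + sumℚ (λ i → if U (suc i) then a else 0ℚ) ≡⟨ cong (a +_) (sumℚ-indicator (λ i → U (suc i)) a) ⟩
  a + a * ℕtoℚ s                               ≡⟨ solve 2 (λ a m → a :+ a :* m := a :* (con 1ℚ :+ m)) refl a (ℕtoℚ s) ⟩
  a * (1ℚ + ℕtoℚ s)                            ≡⟨ cong (a *_) (sym (ℕtoℚ-suc s)) ⟩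
  a * ℕtoℚ (suc s)                             ∎
  where
    open ≡-Reasoning
    s = size (λ i → U (suc i))
... | false = trans (+-identityˡ _) (sumℚ-indicator (λ i → U (suc i)) a)

nonzero⇒∈ : ∀ {S : Indices n} {w} j → SupportedIn S w → w j ≢ 0ℚ → S j ≡ true
nonzero⇒∈ {S = S} j supp wj≢0 with S j in eq
... | true  = refl
... | false = ⊥-elim (wj≢0 (supp j eq))

heavy-entry : ∀ (w : Fin n → ℚ) (U : Indices n) m → (∀ i → 0ℚ ≤ w i) → sumℚ w ≡ 1ℚ → SupportedIn U w
            → size U ℕ.≤ m → Σ (Fin n) λ j → 1ℚ ≤ w j * ℕtoℚ m
heavy-entry {ℕ.zero} w U m 0≤w () supp size≤m
heavy-entry {suc n}  w U m 0≤w sum≡1 supp size≤m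
  with j , _ , minimal ← argmin (λ _ → ⊤) (λ _ → yes tt) (λ i → - w i) (zero , tt)
  = j , (begin
    1ℚ                                    ≡⟨ sym sum≡1 ⟩
    sumℚ w                                ≤⟨ sumℚ-mono-≤ w≤max ⟩
    sumℚ (λ i → if U i then w j else 0ℚ)  ≡⟨ sumℚ-indicator U (w j) ⟩
    w j * ℕtoℚ (size U)                   ≤⟨ *-monoˡ-≤-0≤ (0≤w j) (ℕtoℚ-mono-≤ size≤m) ⟩
    w j * ℕtoℚ m                          ∎)
  where
    open ≤-Reasoning
    w≤max : ∀ i → w i ≤ (if U i then w j else 0ℚ)
    w≤max i with U i in eq
    ... | true  = subst₂ _≤_ (neg-involutive (w i)) (neg-involutive (w j)) (neg-antimono-≤ (minimal i tt))
    ... | false = ≤-reflexive (supp i eq)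

-- Gaussian elimination

Matrix : ℕ → ℕ → Set
Matrix m n = Fin m → Fin n → ℚ

record KernelVector (M : Matrix m n) (S : Indices n) : Set where
  field
    κ          : Fin n → ℚ
    supported  : SupportedIn S κ
    pivot      : Fin n
    pivot∈S    : S pivot ≡ true
    κ[pivot]≢0 : κ pivot ≢ 0ℚ
    in-kernel  : ∀ i → dot (M i) κ ≡ 0ℚ

InjectiveOn : Matrix m n → Indices n → Set
InjectiveOn M S = ∀ κ → SupportedIn S κ → (∀ i → dot (M i) κ ≡ 0ℚ) → ∀ k → κ k ≡ 0ℚ

module Elimination (M : Matrix (suc m) n) (j : Fin n) (pivot≢0 : M zero j ≢ 0ℚ) where

  private
    π = M zero j

  eliminated : Matrix m n
  eliminated i k = M (suc i) k - (M zero k * inv π) * M (suc i) j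

  dot-eliminated : ∀ i κ →
    dot (eliminated i) κ ≡ dot (M (suc i)) κ - M (suc i) j * (dot (M zero) κ * inv π)
  dot-eliminated i κ = begin
    dot (eliminated i) κ
      ≡⟨ sumℚ-cong (λ k → solve 4 (λ x c m y → (x :- c :* m) :* y := x :* y :- m :* (c :* y)) refl
                              (M (suc i) k) (M zero k * inv π) (M (suc i) j) (κ k)) ⟩
    sumℚ (λ k → M (suc i) k * κ k - M (suc i) j * ((M zero k * inv π) * κ k))
      ≡⟨ sumℚ-- (λ k → M (suc i) k * κ k) _ ⟩
    dot (M (suc i)) κ - sumℚ (λ k → M (suc i) j * ((M zero k * inv π) * κ k))
      ≡⟨ cong (λ z → dot (M (suc i)) κ - z) (trans (sumℚ-*ˡ (M (suc i) j) (λ k → (M zero k * inv π) * κ k)) (cong (M (suc i) j *_) inner)) ⟩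
    dot (M (suc i)) κ - M (suc i) j * (dot (M zero) κ * inv π) ∎
    where
      open ≡-Reasoning
      inner : sumℚ (λ k → (M zero k * inv π) * κ k) ≡ dot (M zero) κ * inv π
      inner = trans (sumℚ-cong (λ k → solve 3 (λ a b c → (a :* b) :* c := (a :* c) :* b) refl (M zero k) (inv π) (κ k)))
                    (sumℚ-*ʳ (inv π) (λ k → M zero k * κ k))

  -- Adding the right multiple of the j-th unit vector kills the pivot row.
  lift-kernel : {S : Indices n} → S j ≡ true → KernelVector eliminated (S ∖ j) → KernelVector M S
  lift-kernel {S} j∈S K′ = record
    { κ = κ ; supported = supported ; pivot = K′.pivot ; pivot∈S = proj₁ (∖-true {S = S} {j} K′.pivot∈S)
    ; κ[pivot]≢0 = κ[pivot]≢0 ; in-kernel = in-kernel }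
    where
      module K′ = KernelVector K′
      Σ₀ = dot (M zero) K′.κ
      a = - Σ₀ * inv π
      κ : Fin n → ℚ
      κ k = K′.κ k + a * δ j k
      off-j : ∀ {k} → j ≢ k → κ k ≡ K′.κ k
      off-j {k} j≢k with j ≟ᶠ k
      ... | yes j≡k = ⊥-elim (j≢k j≡k)
      ... | no  _   = solve 2 (λ x a → x :+ a :* con 0ℚ := x) refl (K′.κ k) a
      supported : SupportedIn S κ
      supported k k∉S = trans (off-j (∈⇒≢ {S = S} j∈S k∉S)) (K′.supported k (cong (_∧ _) k∉S))
      κ[pivot]≢0 : κ K′.pivot ≢ 0ℚ
      κ[pivot]≢0 κ≡0 = K′.κ[pivot]≢0 (trans (sym (off-j (proj₂ (∖-true {S = S} {j} K′.pivot∈S)))) κ≡0)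
      in-kernel : ∀ i → dot (M i) κ ≡ 0ℚ
      in-kernel zero = begin
        dot (M zero) κ              ≡⟨ dot-+δ (M zero) K′.κ j a ⟩
        Σ₀ + π * (- Σ₀ * inv π)     ≡⟨ solve 3 (λ s p q → s :+ p :* (:- s :* q) := s :* (con 1ℚ :- p :* q)) refl Σ₀ π (inv π) ⟩
        Σ₀ * (1ℚ - π * inv π)       ≡⟨ cong (λ z → Σ₀ * (1ℚ - z)) (*-inv pivot≢0) ⟩
        Σ₀ * (1ℚ - 1ℚ)              ≡⟨ solve 1 (λ s → s :* (con 1ℚ :- con 1ℚ) := con 0ℚ) refl Σ₀ ⟩
        0ℚ                          ∎
        where open ≡-Reasoning
      in-kernel (suc i) = begin
        dot (M (suc i)) κ                                       ≡⟨ dot-+δ (M (suc i)) K′.κ j a ⟩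
        dot (M (suc i)) K′.κ + M (suc i) j * (- Σ₀ * inv π)     ≡⟨ solve 4 (λ x m s q → x :+ m :* (:- s :* q) := x :- m :* (s :* q)) refl
                                                                     (dot (M (suc i)) K′.κ) (M (suc i) j) Σ₀ (inv π) ⟩
        dot (M (suc i)) K′.κ - M (suc i) j * (Σ₀ * inv π)       ≡⟨ sym (dot-eliminated i K′.κ) ⟩
        dot (eliminated i) K′.κ                                 ≡⟨ K′.in-kernel i ⟩
        0ℚ                                                      ∎
        where open ≡-Reasoning

  lift-injective : {S : Indices n} → InjectiveOn eliminated (S ∖ j) → InjectiveOn M S
  lift-injective {S} inj κ supp Mκ≡0 = κ≡0
    where
      κ′ = zeroAt j κ
      dot-κ′ : ∀ i → dot (M i) κ′ ≡ - (M i j * κ j)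
      dot-κ′ i = begin
        dot (M i) κ′                                ≡⟨ solve 2 (λ a b → b := (a :+ b) :- a) refl (M i j * κ j) (dot (M i) κ′) ⟩
        (M i j * κ j + dot (M i) κ′) - M i j * κ j   ≡⟨ cong (_- M i j * κ j) (sym (dot-zeroAt (M i) κ j)) ⟩
        dot (M i) κ - M i j * κ j                   ≡⟨ cong (_- M i j * κ j) (Mκ≡0 i) ⟩
        0ℚ - M i j * κ j                            ≡⟨ +-identityˡ _ ⟩
        - (M i j * κ j)                             ∎
        where open ≡-Reasoning
      eliminated-κ′ : ∀ i → dot (eliminated i) κ′ ≡ 0ℚ
      eliminated-κ′ i = begin
        dot (eliminated i) κ′                                       ≡⟨ dot-eliminated i κ′ ⟩
        dot (M (suc i)) κ′ - M (suc i) j * (dot (M zero) κ′ * inv π) ≡⟨ cong (λ x → x - M (suc i) j * (dot (M zero) κ′ * inv π)) (dot-κ′ (suc i)) ⟩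
        - (M (suc i) j * κ j) - M (suc i) j * (dot (M zero) κ′ * inv π) ≡⟨ cong (λ y → - (M (suc i) j * κ j) - M (suc i) j * (y * inv π)) (dot-κ′ zero) ⟩
        - (M (suc i) j * κ j) - M (suc i) j * (- (π * κ j) * inv π)  ≡⟨ solve 4 (λ m k p q → :- (m :* k) :- m :* (:- (p :* k) :* q) := m :* k :* (p :* q :- con 1ℚ)) refl
                                                                         (M (suc i) j) (κ j) π (inv π) ⟩
        M (suc i) j * κ j * (π * inv π - 1ℚ)                          ≡⟨ cong (λ z → M (suc i) j * κ j * (z - 1ℚ)) (*-inv pivot≢0) ⟩
        M (suc i) j * κ j * (1ℚ - 1ℚ)                                 ≡⟨ trans (cong (M (suc i) j * κ j *_) (+-inverseʳ 1ℚ)) (*-zeroʳ (M (suc i) j * κ j)) ⟩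
        0ℚ                                                           ∎
        where open ≡-Reasoning
      κ′≡0 : ∀ k → κ′ k ≡ 0ℚ
      κ′≡0 = inj κ′ (zeroAt-supported {S = S} j supp) eliminated-κ′
      κj≡0 : κ j ≡ 0ℚ
      κj≡0 = *-cancelˡ-≡0 pivot≢0 (begin
        π * κ j                  ≡⟨ neg-involutive (π * κ j) ⟨
        - - (π * κ j)            ≡⟨ cong -_ (dot-κ′ zero) ⟨
        - dot (M zero) κ′        ≡⟨ cong -_ M₀κ′≡0 ⟩
        - 0ℚ                     ≡⟨⟩
        0ℚ                       ∎)
        where open ≡-Reasoning
              M₀κ′≡0 : dot (M zero) κ′ ≡ 0ℚ
              M₀κ′≡0 = trans (sumℚ-cong (λ k → trans (cong (M zero k *_) (κ′≡0 k)) (*-zeroʳ (M zero k)))) (sumℚ-0 {n})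
      κ≡0 : ∀ k → κ k ≡ 0ℚ
      κ≡0 k with j ≟ᶠ k
      ... | yes refl = κj≡0
      ... | no  j≢k  = trans (sym (zeroAt-≢ j κ j≢k)) (κ′≡0 k)

dot-vanishing : ∀ {S : Indices n} {f κ} → (∀ k → S k ≡ true → f k ≡ 0ℚ) → SupportedIn S κ → dot f κ ≡ 0ℚ
dot-vanishing {n} {S} {f} {κ} f≡0 supp = trans (sumℚ-cong term≡0) (sumℚ-0 {n})
  where
    term≡0 : ∀ k → f k * κ k ≡ 0ℚ
    term≡0 k with S k in eq
    ... | true  = trans (cong (_* κ k) (f≡0 k eq)) (*-zeroˡ (κ k))
    ... | false = trans (cong (f k *_) (supp k eq)) (*-zeroʳ (f k))

kernel-or-injective : (M : Matrix m n) (S : Indices n) → KernelVector M S ⊎ (InjectiveOn M S × size S ℕ.≤ m)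
kernel-or-injective {ℕ.zero} M S with any? (λ j → S j ≟ᵇ true)
... | yes (j , j∈S) = inj₁ (record
  { κ = δ j ; supported = supported ; pivot = j ; pivot∈S = j∈S
  ; κ[pivot]≢0 = δjj≢0 ; in-kernel = λ () })
  where
    supported : SupportedIn S (δ j)
    supported k k∉S with j ≟ᶠ k
    ... | yes refl with () ← trans (sym j∈S) k∉S
    ... | no  _    = refl
    δjj≢0 : δ j j ≢ 0ℚ
    δjj≢0 rewrite dec-true (j ≟ᶠ j) refl = 1≢0
... | no S≡∅ = inj₂ ( (λ κ supp _ k → supp k (¬-not (λ k∈S → S≡∅ (k , k∈S))))
                    , ℕ.≤-reflexive (size-∅ (λ k → ¬-not (λ k∈S → S≡∅ (k , k∈S)))))
kernel-or-injective {suc m} M S with any? (λ j → (S j ≟ᵇ true) ×-dec ¬? (M zero j ≟ 0ℚ))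
... | yes (j , j∈S , pivot≢0) = pivot-step (kernel-or-injective eliminated (S ∖ j))
  where
    open Elimination M j pivot≢0
    pivot-step : KernelVector eliminated (S ∖ j) ⊎ (InjectiveOn eliminated (S ∖ j) × size (S ∖ j) ℕ.≤ m)
               → KernelVector M S ⊎ (InjectiveOn M S × size S ℕ.≤ suc m)
    pivot-step (inj₁ K)             = inj₁ (lift-kernel j∈S K)
    pivot-step (inj₂ (inj , size≤m)) =
      inj₂ (lift-injective inj , subst (ℕ._≤ suc m) (sym (size-∖ {S = S} j j∈S)) (ℕ.s≤s size≤m))
... | no no-pivot = zero-row-step (kernel-or-injective (λ i → M (suc i)) S)
  where
    row₀≡0 : ∀ k → S k ≡ true → M zero k ≡ 0ℚ
    row₀≡0 k k∈S with M zero k ≟ 0ℚ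
    ... | yes M₀k≡0 = M₀k≡0
    ... | no  M₀k≢0 = ⊥-elim (no-pivot (k , k∈S , M₀k≢0))
    zero-row-step : KernelVector (λ i → M (suc i)) S ⊎ (InjectiveOn (λ i → M (suc i)) S × size S ℕ.≤ m)
                  → KernelVector M S ⊎ (InjectiveOn M S × size S ℕ.≤ suc m)
    zero-row-step (inj₁ K) = inj₁ (record
      { κ = K.κ ; supported = K.supported ; pivot = K.pivot ; pivot∈S = K.pivot∈S ; κ[pivot]≢0 = K.κ[pivot]≢0
      ; in-kernel = λ { zero → dot-vanishing row₀≡0 K.supported ; (suc i) → K.in-kernel i } })
      where module K = KernelVector K
    zero-row-step (inj₂ (inj , size≤m)) =
      inj₂ ((λ κ supp Mκ≡0 → inj κ supp (λ i → Mκ≡0 (suc i))) , ℕ.m≤n⇒m≤1+n size≤m)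

-- Convex hulls of finitely many points

affineMatrix : ∀ {d} → (Fin n → Point d) → Matrix (suc d) n
affineMatrix V zero    i = 1ℚ
affineMatrix V (suc k) i = V i k

full : Indices n
full _ = true

module ConvexHull {d n : ℕ} (V : Fin n → Point d) where

  record Barycentric (S : Indices n) (x : Point d) (w : Fin n → ℚ) : Set where
    field
      nonneg    : ∀ i → 0ℚ ≤ w i
      supported : SupportedIn S w
      sum≡1     : sumℚ w ≡ 1ℚ
      combines  : ∀ k → sumℚ (λ i → w i * V i k) ≡ x k

  ConvOn : Indices n → Point d → Set
  ConvOn S x = Σ (Fin n → ℚ) (Barycentric S x)

  Conv⇒ConvOn-full : ∀ {x} → Conv V x → ConvOn full x
  Conv⇒ConvOn-full (w , 0≤w , sum≡1 , combines) = w , record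
    { nonneg = 0≤w ; supported = λ _ () ; sum≡1 = sum≡1 ; combines = combines }

  ConvOn⇒Conv : ∀ {S x} → ConvOn S x → Conv V x
  ConvOn⇒Conv (w , b) = w , nonneg , sum≡1 , combines
    where open Barycentric b

  Barycentric-∖ : ∀ {S x w} j → Barycentric (S ∖ j) x w → Barycentric S x w
  Barycentric-∖ {S} j b = record
    { nonneg = nonneg ; supported = SupportedIn-∖ {S = S} j supported ; sum≡1 = sum≡1 ; combines = combines }
    where open Barycentric b

  Barycentric-combine : ∀ {S y z α β} a b → 0ℚ ≤ a → 0ℚ ≤ b → a + b ≡ 1ℚ
    → Barycentric S y α → Barycentric S z β
    → Barycentric S (λ k → a * y k + b * z k) (λ i → a * α i + b * β i)
  Barycentric-combine {S} {y} {z} {α} {β} a b 0≤a 0≤b a+b≡1 bα bβ = record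
    { nonneg    = λ i → +-mono-≤ (0≤* 0≤a (Bα.nonneg i)) (0≤* 0≤b (Bβ.nonneg i))
    ; supported = supported
    ; sum≡1     = begin
        sumℚ (λ i → a * α i + b * β i) ≡⟨ sumℚ-linear a b α β ⟩
        a * sumℚ α + b * sumℚ β        ≡⟨ cong₂ (λ s t → a * s + b * t) Bα.sum≡1 Bβ.sum≡1 ⟩
        a * 1ℚ + b * 1ℚ                ≡⟨ cong₂ _+_ (*-identityʳ a) (*-identityʳ b) ⟩
        a + b                          ≡⟨ a+b≡1 ⟩
        1ℚ                             ∎
    ; combines  = λ k → begin
        sumℚ (λ i → (a * α i + b * β i) * V i k)
          ≡⟨ sumℚ-cong (λ i → solve 5 (λ a x b y v → (a :* x :+ b :* y) :* v := a :* (x :* v) :+ b :* (y :* v)) refl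
                                 a (α i) b (β i) (V i k)) ⟩
        sumℚ (λ i → a * (α i * V i k) + b * (β i * V i k))
          ≡⟨ sumℚ-linear a b (λ i → α i * V i k) (λ i → β i * V i k) ⟩
        a * sumℚ (λ i → α i * V i k) + b * sumℚ (λ i → β i * V i k)
          ≡⟨ cong₂ (λ s t → a * s + b * t) (Bα.combines k) (Bβ.combines k) ⟩
        a * y k + b * z k ∎ }
    where
      open ≡-Reasoning
      module Bα = Barycentric bα
      module Bβ = Barycentric bβ
      supported : SupportedIn S (λ i → a * α i + b * β i)
      supported i i∉S rewrite Bα.supported i i∉S | Bβ.supported i i∉S =
        solve 2 (λ a b → a :* con 0ℚ :+ b :* con 0ℚ := con 0ℚ) refl a b

  kernel-sum≡0 : ∀ {κ} → (∀ r → dot (affineMatrix V r) κ ≡ 0ℚ) → sumℚ κ ≡ 0ℚ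
  kernel-sum≡0 {κ} in-kernel = trans (sumℚ-cong (λ k → sym (*-identityˡ (κ k)))) (in-kernel zero)

  kernel-combination≡0 : ∀ {κ} → (∀ r → dot (affineMatrix V r) κ ≡ 0ℚ) → ∀ c → sumℚ (λ i → κ i * V i c) ≡ 0ℚ
  kernel-combination≡0 {κ} in-kernel c = trans (sumℚ-cong (λ i → *-comm (κ i) (V i c))) (in-kernel (suc c))

  -- An affine dependence has entries of both signs, since its entries sum to 0.
  kernel-positive-entry : ∀ {S} → (K : KernelVector (affineMatrix V) S)
    → Σ (Fin n) λ j → S j ≡ true × 0ℚ < KernelVector.κ K j
  kernel-positive-entry {S} K with any? (λ j → (S j ≟ᵇ true) ×-dec (0ℚ <? κ j))
    where open KernelVector K
  ... | yes found = found
  ... | no none = ⊥-elim (κ[pivot]≢0 (trans (sym (neg-involutive (κ pivot)))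
                   (cong -_ (sumℚ≡0⇒≡0 0≤-κ sum-κ≡0 pivot))))
    where
      open KernelVector K
      0≤-κ : ∀ j → 0ℚ ≤ - κ j
      0≤-κ j with S j in eq
      ... | true  = neg-antimono-≤ (≮⇒≥ (λ 0<κj → none (j , eq , 0<κj)))
      ... | false = ≤-reflexive (sym (cong -_ (supported j eq)))
      sum-κ≡0 : sumℚ (λ j → - κ j) ≡ 0ℚ
      sum-κ≡0 = trans (sumℚ-neg κ) (cong -_ (kernel-sum≡0 in-kernel))

  Barycentric-drop : ∀ {S x w} j → Barycentric S x w → w j ≡ 0ℚ → Barycentric (S ∖ j) x w
  Barycentric-drop {S} j b wj≡0 = record
    { nonneg = nonneg ; supported = supported′ ; sum≡1 = sum≡1 ; combines = combines }
    where
      open Barycentric b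
      supported′ : SupportedIn (S ∖ j) _
      supported′ i i∉S∖j with ∖-false {S = S} {j} {i} i∉S∖j
      ... | inj₁ i∉S  = supported i i∉S
      ... | inj₂ refl = wj≡0

  shift-along-kernel : ∀ {S x w} → Barycentric S x w → (K : KernelVector (affineMatrix V) S)
    → let κ = KernelVector.κ K in
      ∀ t → 0ℚ ≤ t → (∀ i → S i ≡ true → 0ℚ < κ i → t * κ i ≤ w i)
    → Barycentric S x (λ i → w i - t * κ i)
  shift-along-kernel {S} {x} {w} b K t 0≤t tκ≤w = record
    { nonneg = 0≤w′ ; supported = off-S ; sum≡1 = sum≡1′ ; combines = combines′ }
    where
      open Barycentric b
      open KernelVector K using (κ; in-kernel) renaming (supported to κ-supported)
      w′ : Fin n → ℚ
      w′ i = w i - t * κ i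
      off-S : ∀ i → S i ≡ false → w′ i ≡ 0ℚ
      off-S i i∉S rewrite supported i i∉S | κ-supported i i∉S = solve 1 (λ t → con 0ℚ :- t :* con 0ℚ := con 0ℚ) refl t
      0≤w′ : ∀ i → 0ℚ ≤ w′ i
      0≤w′ i with S i in eq | 0ℚ <? κ i
      ... | false | _        = ≤-reflexive (sym (off-S i eq))
      ... | true  | yes 0<κi = 0≤q-p (tκ≤w i eq 0<κi)
      ... | true  | no  0≮κi = ≤-trans (+-mono-≤ (nonneg i) (0≤* 0≤t (neg-antimono-≤ (≮⇒≥ 0≮κi))))
                                 (≤-reflexive (solve 3 (λ a t k → a :+ t :* (:- k) := a :- t :* k) refl (w i) t (κ i)))
      sum≡1′ : sumℚ w′ ≡ 1ℚ
      sum≡1′ = begin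
        sumℚ w′                       ≡⟨ sumℚ-- w (λ i → t * κ i) ⟩
        sumℚ w - sumℚ (λ i → t * κ i) ≡⟨ cong₂ _-_ sum≡1 (trans (sumℚ-*ˡ t κ) (cong (t *_) (kernel-sum≡0 in-kernel))) ⟩
        1ℚ - t * 0ℚ                   ≡⟨ cong (λ z → 1ℚ - z) (*-zeroʳ t) ⟩
        1ℚ - 0ℚ                       ≡⟨⟩
        1ℚ                            ∎
        where open ≡-Reasoning
      combines′ : ∀ c → sumℚ (λ i → w′ i * V i c) ≡ x c
      combines′ c = begin
        sumℚ (λ i → w′ i * V i c)
          ≡⟨ sumℚ-cong (λ i → solve 4 (λ a t k v → (a :- t :* k) :* v := a :* v :- t :* (k :* v)) refl (w i) t (κ i) (V i c)) ⟩
        sumℚ (λ i → w i * V i c - t * (κ i * V i c))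
          ≡⟨ sumℚ-- (λ i → w i * V i c) (λ i → t * (κ i * V i c)) ⟩
        sumℚ (λ i → w i * V i c) - sumℚ (λ i → t * (κ i * V i c))
          ≡⟨ cong₂ _-_ (combines c) (trans (sumℚ-*ˡ t (λ i → κ i * V i c)) (cong (t *_) (kernel-combination≡0 in-kernel c))) ⟩
        x c - t * 0ℚ
          ≡⟨ solve 2 (λ x t → x :- t :* con 0ℚ := x) refl (x c) t ⟩
        x c ∎
        where open ≡-Reasoning

  -- Carathéodory's exchange: move along the affine dependence until a first weight vanishes.
  drop-generator : ∀ {S x w} → Barycentric S x w → KernelVector (affineMatrix V) S
                 → Σ (Fin n) λ j → S j ≡ true × ConvOn (S ∖ j) x
  drop-generator {S} {x} {w} b K = exchange (argmin Pos Pos? (λ j → w j * inv (κ j)) (kernel-positive-entry K))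
    where
      open Barycentric b
      open KernelVector K using (κ)
      Pos : Fin n → Set
      Pos j = S j ≡ true × 0ℚ < κ j
      Pos? : ∀ j → Dec (Pos j)
      Pos? j = (S j ≟ᵇ true) ×-dec (0ℚ <? κ j)
      exchange : Σ (Fin n) (λ j → Pos j × (∀ k → Pos k → w j * inv (κ j) ≤ w k * inv (κ k)))
               → Σ (Fin n) λ j → S j ≡ true × ConvOn (S ∖ j) x
      exchange (j , (j∈S , 0<κj) , minimal) =
        j , j∈S , _ , Barycentric-drop j (shift-along-kernel b K t (0≤* (nonneg j) (0≤inv 0<κj)) tκ≤w) w′j≡0
        where
          t = w j * inv (κ j)
          tκ≤w : ∀ i → S i ≡ true → 0ℚ < κ i → t * κ i ≤ w i
          tκ≤w i i∈S 0<κi = begin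
            t * κ i                  ≤⟨ *-monoʳ-≤-0≤ (<⇒≤ 0<κi) (minimal i (i∈S , 0<κi)) ⟩
            w i * inv (κ i) * κ i    ≡⟨ solve 3 (λ a b c → a :* b :* c := a :* (c :* b)) refl (w i) (inv (κ i)) (κ i) ⟩
            w i * (κ i * inv (κ i))  ≡⟨ cong (w i *_) (*-inv (pos⇒≢0 0<κi)) ⟩
            w i * 1ℚ                 ≡⟨ *-identityʳ (w i) ⟩
            w i                      ∎
            where open ≤-Reasoning
          w′j≡0 : w j - t * κ j ≡ 0ℚ
          w′j≡0 = begin
            w j - w j * inv (κ j) * κ j    ≡⟨ solve 3 (λ a q k → a :- a :* q :* k := a :* (con 1ℚ :- k :* q)) refl (w j) (inv (κ j)) (κ j) ⟩
            w j * (1ℚ - κ j * inv (κ j))   ≡⟨ cong (λ z → w j * (1ℚ - z)) (*-inv (pos⇒≢0 0<κj)) ⟩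
            w j * (1ℚ - 1ℚ)                ≡⟨ cong (w j *_) (+-inverseʳ 1ℚ) ⟩
            w j * 0ℚ                       ≡⟨ *-zeroʳ (w j) ⟩
            0ℚ                             ∎
            where open ≡-Reasoning

  SmallSupport : Indices n → Point d → Set
  SmallSupport S x = Σ (Indices n) λ U → Σ (Fin n → ℚ) λ w → Barycentric S x w × SupportedIn U w × size U ℕ.≤ suc d

  caratheodory : ∀ f {S x w} → size S ℕ.≤ f → Barycentric S x w → SmallSupport S x
  caratheodory-step : ∀ f {S x w} → size S ℕ.≤ f → Barycentric S x w
    → KernelVector (affineMatrix V) S ⊎ (InjectiveOn (affineMatrix V) S × size S ℕ.≤ suc d) → SmallSupport S x

  caratheodory f {S} size≤f b = caratheodory-step f size≤f b (kernel-or-injective (affineMatrix V) S)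

  caratheodory-step f {S} {x} {w} _ b (inj₂ (_ , size≤1+d)) = S , w , b , Barycentric.supported b , size≤1+d
  caratheodory-step ℕ.zero {S} size≤0 b (inj₁ K) =
    ⊥-elim (∈⇒size≢0 {S = S} (KernelVector.pivot K) (KernelVector.pivot∈S K) (ℕ.n≤0⇒n≡0 size≤0))
  caratheodory-step (suc f) {S} {x} size≤1+f b (inj₁ K) = recurse (drop-generator b K)
    where
      widen : ∀ j → SmallSupport (S ∖ j) x → SmallSupport S x
      widen j (U , w′ , b′ , U-supp , size≤1+d) = U , w′ , Barycentric-∖ j b′ , U-supp , size≤1+d
      recurse : Σ (Fin n) (λ j → S j ≡ true × ConvOn (S ∖ j) x) → SmallSupport S x
      recurse (j , j∈S , w″ , b″) = widen j (caratheodory f (size-∖-≤ {S = S} j j∈S size≤1+f) b″)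

  affine-unique : ∀ {S w v} → InjectiveOn (affineMatrix V) S → SupportedIn S w → SupportedIn S v
    → sumℚ w ≡ sumℚ v → (∀ c → sumℚ (λ i → w i * V i c) ≡ sumℚ (λ i → v i * V i c)) → ∀ i → w i ≡ v i
  affine-unique {S} {w} {v} inj w-supp v-supp sum≡ comb≡ i = begin
    w i               ≡⟨ solve 2 (λ a b → a := (a :- b) :+ b) refl (w i) (v i) ⟩
    (w i - v i) + v i ≡⟨ cong (_+ v i) (inj (λ k → w k - v k) supported in-kernel i) ⟩
    0ℚ + v i          ≡⟨ +-identityˡ (v i) ⟩
    v i               ∎
    where
      open ≡-Reasoning
      supported : SupportedIn S (λ k → w k - v k)
      supported k k∉S rewrite w-supp k k∉S | v-supp k k∉S = refl
      in-kernel : ∀ r → dot (affineMatrix V r) (λ k → w k - v k) ≡ 0ℚ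
      in-kernel zero = trans (sumℚ-cong (λ k → *-identityˡ (w k - v k)))
                             (trans (sumℚ-- w v) (trans (cong (_- sumℚ v) sum≡) (+-inverseʳ (sumℚ v))))
      in-kernel (suc c) = begin
        sumℚ (λ k → V k c * (w k - v k))
          ≡⟨ sumℚ-cong (λ k → solve 3 (λ x a b → x :* (a :- b) := a :* x :- b :* x) refl (V k c) (w k) (v k)) ⟩
        sumℚ (λ k → w k * V k c - v k * V k c)
          ≡⟨ sumℚ-- (λ k → w k * V k c) (λ k → v k * V k c) ⟩
        sumℚ (λ k → w k * V k c) - sumℚ (λ k → v k * V k c)
          ≡⟨ cong (_- sumℚ (λ k → v k * V k c)) (comb≡ c) ⟩
        sumℚ (λ k → v k * V k c) - sumℚ (λ k → v k * V k c)
          ≡⟨ +-inverseʳ (sumℚ (λ k → v k * V k c)) ⟩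
        0ℚ ∎

  dot-affineMatrix-∷ : ∀ x r (κ : Fin (suc n) → ℚ)
    → dot (affineMatrix (x ∷ V) r) κ ≡ affineMatrix (x ∷ V) r zero * κ zero + dot (affineMatrix V r) (λ k → κ (suc k))
  dot-affineMatrix-∷ x zero    κ = refl
  dot-affineMatrix-∷ x (suc c) κ = refl

  -- A dependence κ of x, V₀, …, V_{n-1} with κ₀ ≠ 0 expresses x as the affine combination -κᵢ₊₁/κ₀ of the Vᵢ.
  affine-solution : ∀ {S x} → InjectiveOn (affineMatrix V) S → KernelVector (affineMatrix (x ∷ V)) (true ∷ S)
    → Σ (Fin n → ℚ) λ μ → SupportedIn S μ × sumℚ μ ≡ 1ℚ × (∀ c → sumℚ (λ i → μ i * V i c) ≡ x c)
  affine-solution {S} {x} inj K⁺ = μ , μ-supported , μ-sum , μ-combines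
    where
      open KernelVector K⁺
      κ₀ = κ zero
      tail-kernel : κ₀ ≡ 0ℚ → ∀ r → dot (affineMatrix V r) (λ k → κ (suc k)) ≡ 0ℚ
      tail-kernel κ₀≡0 r = begin
        dot (affineMatrix V r) (λ k → κ (suc k))
          ≡⟨ solve 2 (λ a s → s := a :* con 0ℚ :+ s) refl (affineMatrix (x ∷ V) r zero) (dot (affineMatrix V r) (λ k → κ (suc k))) ⟩
        affineMatrix (x ∷ V) r zero * 0ℚ + dot (affineMatrix V r) (λ k → κ (suc k))
          ≡⟨ cong (λ z → affineMatrix (x ∷ V) r zero * z + dot (affineMatrix V r) (λ k → κ (suc k))) (sym κ₀≡0) ⟩
        affineMatrix (x ∷ V) r zero * κ₀ + dot (affineMatrix V r) (λ k → κ (suc k))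
          ≡⟨ sym (dot-affineMatrix-∷ x r κ) ⟩
        dot (affineMatrix (x ∷ V) r) κ
          ≡⟨ in-kernel r ⟩
        0ℚ ∎
        where open ≡-Reasoning
      κ₀≢0 : κ₀ ≢ 0ℚ
      κ₀≢0 κ₀≡0 = κ[pivot]≢0 (κ≡0 pivot)
        where
          κ≡0 : ∀ k → κ k ≡ 0ℚ
          κ≡0 zero    = κ₀≡0
          κ≡0 (suc k) = inj (λ k → κ (suc k)) (λ k → supported (suc k)) (tail-kernel κ₀≡0) k
      μ : Fin n → ℚ
      μ i = - κ (suc i) * inv κ₀
      μ-supported : SupportedIn S μ
      μ-supported i i∉S rewrite supported (suc i) i∉S = solve 1 (λ q → :- con 0ℚ :* q := con 0ℚ) refl (inv κ₀)
      solve-row : ∀ a (a* : Fin n → ℚ) → a * κ₀ + sumℚ (λ i → a* i * κ (suc i)) ≡ 0ℚ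
                → sumℚ (λ i → a* i * μ i) ≡ a
      solve-row a a* row = begin
        sumℚ (λ i → a* i * μ i)
          ≡⟨ sumℚ-cong (λ i → solve 3 (λ v k q → v :* (:- k :* q) := (:- (v :* k)) :* q) refl (a* i) (κ (suc i)) (inv κ₀)) ⟩
        sumℚ (λ i → - (a* i * κ (suc i)) * inv κ₀)
          ≡⟨ trans (sumℚ-*ʳ (inv κ₀) (λ i → - (a* i * κ (suc i)))) (cong (_* inv κ₀) (sumℚ-neg (λ i → a* i * κ (suc i)))) ⟩
        - Σ′ * inv κ₀
          ≡⟨ cong (λ z → - z * inv κ₀) (trans (solve 2 (λ a s → s := (a :+ s) :- a) refl (a * κ₀) Σ′) (cong (_- a * κ₀) row)) ⟩
        - (0ℚ - a * κ₀) * inv κ₀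
          ≡⟨ solve 3 (λ a c q → :- (con 0ℚ :- a :* c) :* q := a :* (c :* q)) refl a κ₀ (inv κ₀) ⟩
        a * (κ₀ * inv κ₀)
          ≡⟨ cong (a *_) (*-inv κ₀≢0) ⟩
        a * 1ℚ
          ≡⟨ *-identityʳ a ⟩
        a ∎
        where
          open ≡-Reasoning
          Σ′ = sumℚ (λ i → a* i * κ (suc i))
      μ-sum : sumℚ μ ≡ 1ℚ
      μ-sum = trans (sumℚ-cong (λ i → sym (*-identityˡ (μ i)))) (solve-row 1ℚ (λ _ → 1ℚ) (in-kernel zero))
      μ-combines : ∀ c → sumℚ (λ i → μ i * V i c) ≡ x c
      μ-combines c = trans (sumℚ-cong (λ i → *-comm (μ i) (V i c))) (solve-row (x c) (λ i → V i c) (in-kernel (suc c)))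

  conv?-injective : ∀ {S} → InjectiveOn (affineMatrix V) S → ∀ x → Dec (ConvOn S x)
  conv?-injective {S} inj x = decide (kernel-or-injective (affineMatrix (x ∷ V)) (true ∷ S))
    where
      -- Barycentric coordinates w of x give the dependence (-1, w) of x, V₀, …, V_{n-1}.
      dependence : ∀ {w} → Barycentric S x w → ∀ r → dot (affineMatrix (x ∷ V) r) (- 1ℚ ∷ w) ≡ 0ℚ
      dependence {w} b zero = trans (cong (1ℚ * - 1ℚ +_) (trans (sumℚ-cong (λ k → *-identityˡ (w k))) (Barycentric.sum≡1 b))) refl
      dependence {w} b (suc c) = begin
        x c * - 1ℚ + sumℚ (λ k → V k c * w k) ≡⟨ cong (x c * - 1ℚ +_) (trans (sumℚ-cong (λ k → *-comm (V k c) (w k))) (Barycentric.combines b c)) ⟩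
        x c * - 1ℚ + x c                      ≡⟨ solve 1 (λ a → a :* (:- con 1ℚ) :+ a := con 0ℚ) refl (x c) ⟩
        0ℚ                                    ∎
        where open ≡-Reasoning
      decide : KernelVector (affineMatrix (x ∷ V)) (true ∷ S)
             ⊎ (InjectiveOn (affineMatrix (x ∷ V)) (true ∷ S) × size (true ∷ S) ℕ.≤ suc d)
             → Dec (ConvOn S x)
      decide (inj₂ (inj⁺ , _)) = no λ (w , b) →
        -1≢0 (inj⁺ (- 1ℚ ∷ w) (λ { (suc k) k∉S → Barycentric.supported b k k∉S }) (dependence b) zero)
        where
          -1≢0 : - 1ℚ ≢ 0ℚ
          -1≢0 ()
      decide (inj₁ K⁺) = check-nonneg (affine-solution inj K⁺)
        where
          check-nonneg : Σ (Fin n → ℚ) (λ μ → SupportedIn S μ × sumℚ μ ≡ 1ℚ × (∀ c → sumℚ (λ i → μ i * V i c) ≡ x c))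
                       → Dec (ConvOn S x)
          check-nonneg (μ , μ-supported , μ-sum , μ-combines) with all? (λ i → 0ℚ ≤? μ i)
          ... | yes 0≤μ = yes (μ , record { nonneg = 0≤μ ; supported = μ-supported ; sum≡1 = μ-sum ; combines = μ-combines })
          ... | no  0≰μ = no λ (w , b) → 0≰μ λ i → subst (0ℚ ≤_)
                (affine-unique inj (Barycentric.supported b) μ-supported (trans (Barycentric.sum≡1 b) (sym μ-sum))
                               (λ c → trans (Barycentric.combines b c) (sym (μ-combines c))) i)
                (Barycentric.nonneg b i)

  conv? : ∀ f S → size S ℕ.≤ f → ∀ x → Dec (ConvOn S x)
  conv?-step : ∀ f S → size S ℕ.≤ f → ∀ x
    → KernelVector (affineMatrix V) S ⊎ (InjectiveOn (affineMatrix V) S × size S ℕ.≤ suc d) → Dec (ConvOn S x)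

  conv? f S size≤f x = conv?-step f S size≤f x (kernel-or-injective (affineMatrix V) S)

  conv?-step f S _ x (inj₂ (inj , _)) = conv?-injective inj x
  conv?-step ℕ.zero S size≤0 x (inj₁ K) =
    ⊥-elim (∈⇒size≢0 {S = S} (KernelVector.pivot K) (KernelVector.pivot∈S K) (ℕ.n≤0⇒n≡0 size≤0))
  conv?-step (suc f) S size≤1+f x (inj₁ K) = decide (any? dropped?)
    where
      Dropped : Fin n → Set
      Dropped j = Σ (S j ≡ true) λ _ → ConvOn (S ∖ j) x
      dropped? : ∀ j → Dec (Dropped j)
      dropped? j with S j ≟ᵇ true
      ... | no  j∉S = no λ (j∈S , _) → j∉S j∈S
      ... | yes j∈S with conv? f (S ∖ j) (size-∖-≤ {S = S} j j∈S size≤1+f) x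
      ...   | yes c = yes (j∈S , c)
      ...   | no ¬c = no λ (_ , c) → ¬c c
      decide : Dec (∃ Dropped) → Dec (ConvOn S x)
      decide (yes (j , _ , w , b)) = yes (w , Barycentric-∖ j b)
      decide (no none)             = no λ (w , b) → none (drop-generator b K)

  Barycentric-cong : ∀ {S x y w} → x ≋ y → Barycentric S x w → Barycentric S y w
  Barycentric-cong x≋y b = record
    { nonneg = nonneg ; supported = supported ; sum≡1 = sum≡1 ; combines = λ k → trans (combines k) (x≋y k) }
    where open Barycentric b

  Barycentric-full : ∀ {S x w} → Barycentric S x w → Barycentric full x w
  Barycentric-full b = record
    { nonneg = nonneg ; supported = λ _ () ; sum≡1 = sum≡1 ; combines = combines }
    where open Barycentric b

  generator∈Conv : ∀ j → Conv V (V j)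
  generator∈Conv j = δ j , 0≤δ j , sumℚ-δ j (λ _ → 1ℚ) , λ c → sumℚ-δ-* j (λ i → V i c)

  -- Substitute for V j its expression in terms of the other generators.
  remove-redundant : ∀ {S j x} → ConvOn (S ∖ j) (V j) → ConvOn S x → ConvOn (S ∖ j) x
  remove-redundant {S} {j} {x} (μ , bμ) (w , bw) = w′ , record
    { nonneg = λ i → +-mono-≤ (0≤zeroAt j W.nonneg i) (0≤* (W.nonneg j) (M.nonneg i))
    ; supported = supported′ ; sum≡1 = sum≡1′ ; combines = combines′ }
    where
      module W = Barycentric bw
      module M = Barycentric bμ
      w′ : Fin n → ℚ
      w′ i = zeroAt j w i + w j * μ i
      supported′ : SupportedIn (S ∖ j) w′
      supported′ i i∉S∖j rewrite zeroAt-supported {S = S} j W.supported i i∉S∖j | M.supported i i∉S∖j =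
        solve 1 (λ a → con 0ℚ :+ a :* con 0ℚ := con 0ℚ) refl (w j)
      sum≡1′ : sumℚ w′ ≡ 1ℚ
      sum≡1′ = begin
        sumℚ w′                               ≡⟨ sumℚ-+ (zeroAt j w) (λ i → w j * μ i) ⟩
        sumℚ (zeroAt j w) + sumℚ (λ i → w j * μ i) ≡⟨ cong₂ _+_ (sumℚ-without j w) (trans (sumℚ-*ˡ (w j) μ) (cong (w j *_) M.sum≡1)) ⟩
        (sumℚ w - w j) + w j * 1ℚ             ≡⟨ solve 2 (λ s a → (s :- a) :+ a :* con 1ℚ := s) refl (sumℚ w) (w j) ⟩
        sumℚ w                                ≡⟨ W.sum≡1 ⟩
        1ℚ                                    ∎
        where open ≡-Reasoning
      combines′ : ∀ c → sumℚ (λ i → w′ i * V i c) ≡ x c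
      combines′ c = begin
        sumℚ (λ i → w′ i * V i c)
          ≡⟨ sumℚ-cong (λ i → trans (*-distribʳ-+ (V i c) (zeroAt j w i) (w j * μ i))
                                    (cong₂ _+_ (zeroAt-*ʳ j i w (V i c)) (*-assoc (w j) (μ i) (V i c)))) ⟩
        sumℚ (λ i → zeroAt j (λ k → w k * V k c) i + w j * (μ i * V i c))
          ≡⟨ sumℚ-+ (zeroAt j (λ k → w k * V k c)) (λ i → w j * (μ i * V i c)) ⟩
        sumℚ (zeroAt j (λ k → w k * V k c)) + sumℚ (λ i → w j * (μ i * V i c))
          ≡⟨ cong₂ _+_ (sumℚ-without j (λ k → w k * V k c)) (trans (sumℚ-*ˡ (w j) (λ i → μ i * V i c)) (cong (w j *_) (M.combines c))) ⟩
        (sumℚ (λ k → w k * V k c) - w j * V j c) + w j * V j c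
          ≡⟨ solve 2 (λ s a → (s :- a) :+ a := s) refl (sumℚ (λ k → w k * V k c)) (w j * V j c) ⟩
        sumℚ (λ k → w k * V k c)
          ≡⟨ W.combines c ⟩
        x c ∎
        where open ≡-Reasoning

  Irredundant : Indices n → Set
  Irredundant T = ∀ j → T j ≡ true → ¬ ConvOn (T ∖ j) (V j)

  Spans : Indices n → Set
  Spans T = ∀ {x} → Conv V x → ConvOn T x

  irredundant-generators : ∀ f S → size S ℕ.≤ f → Spans S → Σ (Indices n) λ T → Spans T × Irredundant T
  irredundant-generators ℕ.zero S size≤0 spans =
    S , spans , λ j j∈S _ → ∈⇒size≢0 {S = S} j j∈S (ℕ.n≤0⇒n≡0 size≤0)
  irredundant-generators (suc f) S size≤1+f spans = search (any? redundant?)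
    where
      Redundant : Fin n → Set
      Redundant j = Σ (S j ≡ true) λ _ → ConvOn (S ∖ j) (V j)
      redundant? : ∀ j → Dec (Redundant j)
      redundant? j with S j ≟ᵇ true
      ... | no  j∉S = no λ (j∈S , _) → j∉S j∈S
      ... | yes j∈S with conv? n (S ∖ j) (size≤ (S ∖ j)) (V j)
      ...   | yes c = yes (j∈S , c)
      ...   | no ¬c = no λ (_ , c) → ¬c c
      search : Dec (∃ Redundant) → Σ (Indices n) λ T → Spans T × Irredundant T
      search (no none)             = S , spans , λ j j∈S c → none (j , j∈S , c)
      search (yes (j , j∈S , c)) =
        irredundant-generators f (S ∖ j) (size-∖-≤ {S = S} j j∈S size≤1+f) (λ cx → remove-redundant c (spans cx))

  -- If V j is a convex combination on T with weight μⱼ < 1 on itself, rescaling the other weights by 1/(1 - μⱼ)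
  -- expresses V j without V j.
  renormalise : ∀ {T j μ} → Barycentric T (V j) μ → μ j ≢ 1ℚ → ConvOn (T ∖ j) (V j)
  renormalise {T} {j} {μ} b μj≢1 = ν , record
    { nonneg = λ i → 0≤* (0≤zeroAt j nonneg i) (0≤inv 0<gap)
    ; supported = supported′ ; sum≡1 = sum≡1′ ; combines = combines′ }
    where
      open Barycentric b
      gap = 1ℚ - μ j
      0<gap : 0ℚ < gap
      0<gap = 0<q-p (≤∧≢⇒< (≤-trans (entry≤sumℚ nonneg j) (≤-reflexive sum≡1)) μj≢1)
      gap*inv≡1 : gap * inv gap ≡ 1ℚ
      gap*inv≡1 = *-inv (pos⇒≢0 0<gap)
      ν : Fin n → ℚ
      ν i = zeroAt j μ i * inv gap
      supported′ : SupportedIn (T ∖ j) ν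
      supported′ i i∉T∖j rewrite zeroAt-supported {S = T} j supported i i∉T∖j = *-zeroˡ (inv gap)
      sum≡1′ : sumℚ ν ≡ 1ℚ
      sum≡1′ = begin
        sumℚ ν                       ≡⟨ sumℚ-*ʳ (inv gap) (zeroAt j μ) ⟩
        sumℚ (zeroAt j μ) * inv gap  ≡⟨ cong (_* inv gap) (trans (sumℚ-without j μ) (cong (_- μ j) sum≡1)) ⟩
        gap * inv gap                ≡⟨ gap*inv≡1 ⟩
        1ℚ                           ∎
        where open ≡-Reasoning
      combines′ : ∀ c → sumℚ (λ i → ν i * V i c) ≡ V j c
      combines′ c = begin
        sumℚ (λ i → ν i * V i c)
          ≡⟨ sumℚ-cong (λ i → trans (solve 3 (λ a q v → a :* q :* v := a :* v :* q) refl (zeroAt j μ i) (inv gap) (V i c))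
                                    (cong (_* inv gap) (zeroAt-*ʳ j i μ (V i c)))) ⟩
        sumℚ (λ i → zeroAt j (λ k → μ k * V k c) i * inv gap)
          ≡⟨ sumℚ-*ʳ (inv gap) (zeroAt j (λ k → μ k * V k c)) ⟩
        sumℚ (zeroAt j (λ k → μ k * V k c)) * inv gap
          ≡⟨ cong (_* inv gap) (trans (sumℚ-without j (λ k → μ k * V k c)) (cong (_- μ j * V j c) (combines c))) ⟩
        (V j c - μ j * V j c) * inv gap
          ≡⟨ solve 3 (λ v m q → (v :- m :* v) :* q := v :* ((con 1ℚ :- m) :* q)) refl (V j c) (μ j) (inv gap) ⟩
        V j c * (gap * inv gap)
          ≡⟨ cong (V j c *_) gap*inv≡1 ⟩
        V j c * 1ℚ
          ≡⟨ *-identityʳ (V j c) ⟩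
        V j c ∎
        where open ≡-Reasoning

  irredundant⇒vertex : ∀ {T} → Spans T → Irredundant T → ∀ j → T j ≡ true → IsVertex (Conv V) (V j)
  irredundant⇒vertex {T} spans irredundant j j∈T = generator∈Conv j , extreme
    where
      extreme : ∀ y z t → Conv V y → Conv V z → 0ℚ < t → t < 1ℚ → V j ≋ ((t · y) ⊕ ((1ℚ - t) · z)) → y ≋ z
      extreme y z t y∈P z∈P 0<t t<1 Vj≋ = from-barycentric (spans y∈P) (spans z∈P)
        where
          from-barycentric : ConvOn T y → ConvOn T z → y ≋ z
          from-barycentric (α , bα) (β , bβ) c = trans (y≡Vj c) (sym (z≡Vj c))
            where
              module Bα = Barycentric bα
              module Bβ = Barycentric bβ
              bμ = Barycentric-cong (λ k → sym (Vj≋ k)) (Barycentric-combine t (1ℚ - t) (<⇒≤ 0<t) (0≤q-p (<⇒≤ t<1))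
                     (solve 1 (λ t → t :+ (con 1ℚ :- t) := con 1ℚ) refl t) bα bβ)
              μj≡1 : t * α j + (1ℚ - t) * β j ≡ 1ℚ
              μj≡1 with t * α j + (1ℚ - t) * β j ≟ 1ℚ
              ... | yes μj≡1 = μj≡1
              ... | no  μj≢1 = ⊥-elim (irredundant j j∈T (renormalise bμ μj≢1))
              αj,βj≡1 : α j ≡ 1ℚ × β j ≡ 1ℚ
              αj,βj≡1 = convex-combination≡1 0<t t<1 (≤-trans (entry≤sumℚ Bα.nonneg j) (≤-reflexive Bα.sum≡1))
                          (≤-trans (entry≤sumℚ Bβ.nonneg j) (≤-reflexive Bβ.sum≡1)) μj≡1
              y≡Vj : ∀ c → y c ≡ V j c
              y≡Vj c = trans (sym (Bα.combines c))
                (sumℚ-concentrated α j Bα.nonneg Bα.sum≡1 (proj₁ αj,βj≡1) (λ i → V i c))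
              z≡Vj : ∀ c → z c ≡ V j c
              z≡Vj c = trans (sym (Bβ.combines c))
                (sumℚ-concentrated β j Bβ.nonneg Bβ.sum≡1 (proj₂ αj,βj≡1) (λ i → V i c))

  record HeavyVertex (q : Point d) : Set where
    field
      j           : Fin n
      vertex      : IsVertex (Conv V) (V j)
      w           : Fin n → ℚ
      barycentric : Barycentric full q w
      heavy       : 1ℚ ≤ w j * ℕtoℚ (suc d)

  heavy-vertex : ∀ {q} → Conv V q → HeavyVertex q
  heavy-vertex {q} q∈P =
    let T , spans , irredundant          = irredundant-generators n full (size≤ full) Conv⇒ConvOn-full
        _ , b₀                           = spans q∈P
        U , w , b , U-supp , size≤1+d    = caratheodory n (size≤ T) b₀
        open Barycentric b
        j , heavy                        = heavy-entry w U (suc d) nonneg sum≡1 U-supp size≤1+d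
        wj≢0 : w j ≢ 0ℚ
        wj≢0 wj≡0 = <-irrefl refl (<-≤-trans 0<1 (≤-trans heavy (≤-reflexive
                      (trans (cong (_* ℕtoℚ (suc d)) wj≡0) (*-zeroˡ (ℕtoℚ (suc d)))))))
    in record { j = j ; vertex = irredundant⇒vertex spans irredundant j (nonzero⇒∈ {S = T} j supported wj≢0)
              ; w = w ; barycentric = Barycentric-full b ; heavy = heavy }

  -- For q = Σ wᵢ Vᵢ, the point s (a q − b Vⱼ) has weights s (a wᵢ − b δⱼᵢ), nonnegative as long as b ≤ a wⱼ.
  peel : ∀ {S q w} → Barycentric S q w → ∀ j a b s → 0ℚ ≤ a → 0ℚ ≤ s → b ≤ a * w j → (a - b) * s ≡ 1ℚ
       → Conv V (λ k → (a * q k - b * V j k) * s)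
  peel {S} {q} {w} bw j a b s 0≤a 0≤s b≤awj [a-b]s≡1 = w′ , 0≤w′ , sum≡1′ , combines′
    where
      open Barycentric bw
      w′ : Fin n → ℚ
      w′ i = (a * w i - b * δ j i) * s
      0≤w′ : ∀ i → 0ℚ ≤ w′ i
      0≤w′ i with j ≟ᶠ i
      ... | yes refl = 0≤* (subst (λ z → 0ℚ ≤ a * w j - z) (sym (*-identityʳ b)) (0≤q-p b≤awj)) 0≤s
      ... | no  _    = 0≤* (≤-trans (0≤* 0≤a (nonneg i)) (≤-reflexive (solve 2 (λ a b → a := a :- b :* con 0ℚ) refl (a * w i) b))) 0≤s
      sum≡1′ : sumℚ w′ ≡ 1ℚ
      sum≡1′ = begin
        sumℚ w′                                  ≡⟨ sumℚ-*ʳ s (λ i → a * w i - b * δ j i) ⟩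
        sumℚ (λ i → a * w i - b * δ j i) * s     ≡⟨ cong (_* s) (trans (sumℚ-- (λ i → a * w i) (λ i → b * δ j i))
                                                       (cong₂ _-_ (trans (sumℚ-*ˡ a w) (cong (a *_) sum≡1)) (sumℚ-*ˡ b (δ j)))) ⟩
        (a * 1ℚ - b * sumℚ (δ j)) * s            ≡⟨ cong (λ z → (a * 1ℚ - b * z) * s) (sumℚ-δ j (λ _ → 1ℚ)) ⟩
        (a * 1ℚ - b * 1ℚ) * s                    ≡⟨ cong₂ (λ x y → (x - y) * s) (*-identityʳ a) (*-identityʳ b) ⟩
        (a - b) * s                              ≡⟨ [a-b]s≡1 ⟩
        1ℚ                                       ∎
        where open ≡-Reasoning
      combines′ : ∀ k → sumℚ (λ i → w′ i * V i k) ≡ (a * q k - b * V j k) * s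
      combines′ k = begin
        sumℚ (λ i → w′ i * V i k)
          ≡⟨ sumℚ-cong (λ i → solve 6 (λ a x b e s v → (a :* x :- b :* e) :* s :* v := (a :* (x :* v) :- b :* (e :* v)) :* s)
                                 refl a (w i) b (δ j i) s (V i k)) ⟩
        sumℚ (λ i → (a * (w i * V i k) - b * (δ j i * V i k)) * s)
          ≡⟨ sumℚ-*ʳ s (λ i → a * (w i * V i k) - b * (δ j i * V i k)) ⟩
        sumℚ (λ i → a * (w i * V i k) - b * (δ j i * V i k)) * s
          ≡⟨ cong (_* s) (trans (sumℚ-- (λ i → a * (w i * V i k)) (λ i → b * (δ j i * V i k)))
                (cong₂ _-_ (trans (sumℚ-*ˡ a (λ i → w i * V i k)) (cong (a *_) (combines k)))
                           (trans (sumℚ-*ˡ b (λ i → δ j i * V i k)) (cong (b *_) (sumℚ-δ-* j (λ i → V i k)))))) ⟩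
        (a * q k - b * V j k) * s ∎
        where open ≡-Reasoning

Convex : ∀ {d} → PSet d → Set
Convex P = ∀ {p r} a b → 0ℚ ≤ a → 0ℚ ≤ b → a + b ≡ 1ℚ → P p → P r → P (λ k → a * p k + b * r k)

Conv-convex : ∀ {d} (V : Fin n → Point d) → Convex (Conv V)
Conv-convex V a b 0≤a 0≤b a+b≡1 p∈P r∈P = ConvOn⇒Conv (_ , Barycentric-combine a b 0≤a 0≤b a+b≡1 bp br)
  where
    open ConvexHull V
    bp = proj₂ (Conv⇒ConvOn-full p∈P)
    br = proj₂ (Conv⇒ConvOn-full r∈P)

Conv-≋ : ∀ {d} (V : Fin n → Point d) {x y} → x ≋ y → Conv V x → Conv V y
Conv-≋ V x≋y (w , 0≤w , sum≡1 , combines) = w , 0≤w , sum≡1 , λ k → trans (combines k) (x≋y k)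

-- y = x + r with x = (c-1)p is c times the convex combination ((c-1)/c) p + (1/c) r.
union⊆dilation : ∀ {d} {P : PSet d} → Convex P → ∀ c → 1ℚ ≤ c → ∀ y → UnionSet P c y → (c ·ₛ P) y
union⊆dilation {P = P} convex c 1≤c y (_ , _ , x , (p , p∈P , x≋) , _ , y-x∈P) = p′ , p′∈P , y≋
  where
    0<c : 0ℚ < c
    0<c = <-≤-trans 0<1 1≤c
    c⁻¹ = inv c
    c*c⁻¹≡1 : c * c⁻¹ ≡ 1ℚ
    c*c⁻¹≡1 = *-inv (pos⇒≢0 0<c)
    p′ = λ k → (c - 1ℚ) * c⁻¹ * p k + c⁻¹ * (y ⊖ x) k
    p′∈P : P p′
    p′∈P = convex ((c - 1ℚ) * c⁻¹) c⁻¹ (0≤* (0≤q-p 1≤c) (0≤inv 0<c)) (0≤inv 0<c)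
             (trans (solve 2 (λ c q → (c :- con 1ℚ) :* q :+ q := c :* q) refl c c⁻¹) c*c⁻¹≡1) p∈P y-x∈P
    y≋ : y ≋ (c · p′)
    y≋ k = begin
      y k                                      ≡⟨ solve 2 (λ y x → y := x :+ (y :- x)) refl (y k) (x k) ⟩
      x k + (y k - x k)                        ≡⟨ cong (_+ (y k - x k)) (x≋ k) ⟩
      (c - 1ℚ) * p k + (y k - x k)             ≡⟨ sym (*-identityˡ _) ⟩
      1ℚ * ((c - 1ℚ) * p k + (y k - x k))      ≡⟨ cong (_* ((c - 1ℚ) * p k + (y k - x k))) (sym c*c⁻¹≡1) ⟩
      (c * c⁻¹) * ((c - 1ℚ) * p k + (y k - x k))
        ≡⟨ solve 4 (λ c q p r → (c :* q) :* ((c :- con 1ℚ) :* p :+ r) := c :* ((c :- con 1ℚ) :* q :* p :+ q :* r)) refl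
             c c⁻¹ (p k) (y k - x k) ⟩
      c * p′ k                                 ∎
      where open ≡-Reasoning

-- Part (c)

small-dilation-bound : ∀ d c w → 0ℚ ≤ c → c * ℕtoℚ d ≤ ℕtoℚ d + 1ℚ → 1ℚ ≤ w * ℕtoℚ (suc d) → c - 1ℚ ≤ c * w
small-dilation-bound d c w 0≤c cd≤d+1 heavy = *-cancelʳ-≤-0< 0<1+D
  (≤-by-difference (c * (w * (1ℚ + D) - 1ℚ) + ((D + 1ℚ) - c * D))
    (+-mono-≤ (0≤* 0≤c (0≤q-p heavy′)) (0≤q-p cd≤d+1))
    (solve 3 (λ c w D → c :* w :* (con 1ℚ :+ D) :- (c :- con 1ℚ) :* (con 1ℚ :+ D)
                 := c :* (w :* (con 1ℚ :+ D) :- con 1ℚ) :+ ((D :+ con 1ℚ) :- c :* D)) refl c w D))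
  where
    D = ℕtoℚ d
    0<1+D : 0ℚ < 1ℚ + D
    0<1+D = <-≤-trans (0<ℕtoℚ-suc d) (≤-reflexive (ℕtoℚ-suc d))
    heavy′ : 1ℚ ≤ w * (1ℚ + D)
    heavy′ = ≤-trans heavy (≤-reflexive (cong (w *_) (ℕtoℚ-suc d)))

decomposition-small-dilation : ∀ {d n} (V : Fin n → Point d) c → 1ℚ ≤ c → c * ℕtoℚ d ≤ ℕtoℚ d + 1ℚ
  → DecompEq (Conv V) c
decomposition-small-dilation {d} V c 1≤c cd≤d+1 y = dilation⊆union , union⊆dilation (Conv-convex V) c 1≤c y
  where
    open ConvexHull V
    0≤c = ≤-trans (<⇒≤ 0<1) 1≤c
    dilation⊆union : (c ·ₛ Conv V) y → UnionSet (Conv V) c y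
    dilation⊆union (q , q∈P , y≋) =
        V j , vertex , ((c - 1ℚ) · V j) , (V j , proj₁ vertex , λ _ → refl)
      , (λ k → ℤ.+ 0 , +-inverseʳ ((c - 1ℚ) * V j k))
      , Conv-≋ V (λ k → trans (*-identityʳ _) (cong (_- (c - 1ℚ) * V j k) (sym (y≋ k)))) (peel barycentric j c (c - 1ℚ) 1ℚ 0≤c (<⇒≤ 0<1)
          (small-dilation-bound d c (w j) 0≤c cd≤d+1 heavy) (trans (*-identityʳ _) (solve 1 (λ c → c :- (c :- con 1ℚ) := con 1ℚ) refl c)))
      where open HeavyVertex (heavy-vertex q∈P)

-- Part (a)

ℤ-sub-add : ∀ a b → a ≡ (a ℤ.- b) ℤ.+ b
ℤ-sub-add a b = sym (trans (ℤ.+-assoc a (ℤ.- b) b) (trans (cong (λ t → a ℤ.+ t) (ℤ.+-inverseˡ b)) (ℤ.+-identityʳ a)))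

ℕtoℚ-suc-1 : ∀ m → ℕtoℚ (suc m) - 1ℚ ≡ ℕtoℚ m
ℕtoℚ-suc-1 m = trans (cong (_- 1ℚ) (ℕtoℚ-suc m)) (solve 1 (λ m → (con 1ℚ :+ m) :- con 1ℚ := m) refl (ℕtoℚ m))

module IntegralClosure {d n : ℕ} (V : Fin n → Point d) (lattice : IsLattice (Conv V))
                       (normal : ConvexNormal (ℕtoℚ (suc d)) (Conv V)) where

  open ConvexHull V

  record Split (c : ℕ) (z : Fin d → ℤ) : Set where
    field
      head tail : Fin d → ℤ
      head∈P    : Conv V (embed head)
      tail∈cP   : (ℕtoℚ c ·ₛ Conv V) (embed tail)
      z≡        : ∀ k → z k ≡ head k ℤ.+ tail k

  vertex-coordinates : ∀ {v} → IsVertex (Conv V) v → Σ (Fin d → ℤ) λ vℤ → ∀ k → v k ≡ ℤtoℚ (vℤ k)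
  vertex-coordinates vertex = (λ k → proj₁ (lattice _ vertex k)) , (λ k → proj₂ (lattice _ vertex k))

  -- Convex normality provides x ∈ (c-1)P with x − (c-1)v integral; as v is a lattice point, so is x.
  split-by-normality : ∀ c z → UnionSet (Conv V) (ℕtoℚ (suc (suc c))) (embed z) → Split (suc c) z
  split-by-normality c z (v , vertex , x , (p , p∈P , x≋) , x-integral , z-x∈P) = record
    { tail = xℤ ; head = λ k → z k ℤ.- xℤ k ; tail∈cP = p , p∈P , λ k → trans (xℤ≡x k) (trans (x≋ k) (cong (_* p k) C-1≡M))
    ; head∈P = Conv-≋ V (λ k → sym (trans (ℤtoℚ-homo-- (z k) (xℤ k)) (cong (λ t → ℤtoℚ (z k) - t) (xℤ≡x k)))) z-x∈P
    ; z≡ = λ k → ℤ-sub-add (z k) (xℤ k) }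
    where
      C = ℕtoℚ (suc (suc c))
      M = ℕtoℚ (suc c)
      C-1≡M : C - 1ℚ ≡ M
      C-1≡M = ℕtoℚ-suc-1 (suc c)
      vℤ = proj₁ (vertex-coordinates vertex)
      v≡vℤ = proj₂ (vertex-coordinates vertex)
      xℤ : Fin d → ℤ
      xℤ k = proj₁ (x-integral k) ℤ.+ ℤ.+ (suc c) ℤ.* vℤ k
      xℤ≡x : ∀ k → ℤtoℚ (xℤ k) ≡ x k
      xℤ≡x k = begin
        ℤtoℚ (xℤ k)                          ≡⟨ trans (ℤtoℚ-homo-+ (proj₁ (x-integral k)) _) (cong (ℤtoℚ (proj₁ (x-integral k)) +_) (ℤtoℚ-homo-* (ℤ.+ suc c) (vℤ k))) ⟩
        ℤtoℚ (proj₁ (x-integral k)) + M * ℤtoℚ (vℤ k) ≡⟨ cong₂ (λ a b → a + M * b) (sym (proj₂ (x-integral k))) (sym (v≡vℤ k)) ⟩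
        x k - (C - 1ℚ) * v k + M * v k       ≡⟨ cong (λ t → x k - t * v k + M * v k) C-1≡M ⟩
        x k - M * v k + M * v k              ≡⟨ solve 3 (λ x m v → x :- m :* v :+ m :* v := x) refl (x k) M (v k) ⟩
        x k                                  ∎
        where open ≡-Reasoning

  -- For c ≥ d + 1, peel off a lattice vertex of weight ≥ 1/(d+1) ≥ 1/c.
  split-by-heavy-vertex : ∀ c z q → embed z ≋ (ℕtoℚ (suc (suc c)) · q) → suc d ℕ.≤ suc (suc c) → Conv V q → Split (suc c) z
  split-by-heavy-vertex c z q z≋ d<c q∈P = record
    { tail = λ k → z k ℤ.- vℤ k ; head = vℤ ; tail∈cP = q′ , q′∈P , x≋ ; head∈P = Conv-≋ V v≡vℤ (proj₁ vertex)
    ; z≡ = λ k → trans (ℤ-sub-add (z k) (vℤ k)) (ℤ.+-comm (z k ℤ.- vℤ k) (vℤ k)) }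
    where
      open HeavyVertex (heavy-vertex q∈P)
      C = ℕtoℚ (suc (suc c))
      M = ℕtoℚ (suc c)
      0<M : 0ℚ < M
      0<M = 0<ℕtoℚ-suc c
      M*M⁻¹≡1 : M * inv M ≡ 1ℚ
      M*M⁻¹≡1 = *-inv (pos⇒≢0 0<M)
      vℤ = proj₁ (vertex-coordinates vertex)
      v≡vℤ = proj₂ (vertex-coordinates vertex)
      1≤Cw : 1ℚ ≤ C * w j
      1≤Cw = ≤-trans heavy (≤-trans (*-monoˡ-≤-0≤ (Barycentric.nonneg barycentric j) (ℕtoℚ-mono-≤ d<c)) (≤-reflexive (*-comm (w j) C)))
      q′ = λ k → (C * q k - 1ℚ * V j k) * inv M
      q′∈P : Conv V q′
      q′∈P = peel barycentric j C 1ℚ (inv M) (0≤ℕtoℚ (suc (suc c))) (0≤inv 0<M) 1≤Cw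
              (trans (cong (_* inv M) (ℕtoℚ-suc-1 (suc c))) M*M⁻¹≡1)
      x≋ : embed (λ k → z k ℤ.- vℤ k) ≋ (M · q′)
      x≋ k = begin
        ℤtoℚ (z k ℤ.- vℤ k)                   ≡⟨ ℤtoℚ-homo-- (z k) (vℤ k) ⟩
        ℤtoℚ (z k) - ℤtoℚ (vℤ k)              ≡⟨ cong₂ _-_ (z≋ k) (sym (v≡vℤ k)) ⟩
        C * q k - V j k                       ≡⟨ solve 3 (λ c q v → c :* q :- v := (c :* q :- con 1ℚ :* v) :* con 1ℚ) refl C (q k) (V j k) ⟩
        (C * q k - 1ℚ * V j k) * 1ℚ           ≡⟨ cong ((C * q k - 1ℚ * V j k) *_) (sym M*M⁻¹≡1) ⟩
        (C * q k - 1ℚ * V j k) * (M * inv M)  ≡⟨ solve 3 (λ a m t → a :* (m :* t) := m :* (a :* t)) refl (C * q k - 1ℚ * V j k) M (inv M) ⟩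
        M * q′ k                               ∎
        where open ≡-Reasoning

  split : ∀ c z → (ℕtoℚ (suc (suc c)) ·ₛ Conv V) (embed z) → Split (suc c) z
  split c z (q , q∈P , z≋) with suc (suc c) ℕ.≤? suc d
  ... | yes c≤d = split-by-normality c z (proj₁ (normal (ℕtoℚ (suc (suc c)))
                    (ℕtoℚ-mono-≤ {2} {suc (suc c)} (ℕ.s≤s (ℕ.s≤s ℕ.z≤n))) (ℕtoℚ-mono-≤ c≤d) (embed z)) (q , q∈P , z≋))
  ... | no  c≰d = split-by-heavy-vertex c z q z≋ (ℕ.<⇒≤ (ℕ.≰⇒> c≰d)) q∈P

  LatticeSum : ℕ → (Fin d → ℤ) → Set
  LatticeSum c z = ∃ λ (xs : Fin c → Fin d → ℤ) → (∀ j → Conv V (embed (xs j))) × (∀ k → sumℤ (λ j → xs j k) ≡ z k)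

  prepend : ∀ {c z} (s : Split c z) → LatticeSum c (Split.tail s) → LatticeSum (suc c) z
  prepend s (xs , xs∈P , sum≡) = head ∷ xs , xs′∈P , λ k → trans (cong (λ t → head k ℤ.+ t) (sum≡ k)) (sym (z≡ k))
    where
      open Split s
      xs′∈P : ∀ j → Conv V (embed ((head ∷ xs) j))
      xs′∈P zero    = head∈P
      xs′∈P (suc j) = xs∈P j

  integrally-closed : ∀ c z → (ℕtoℚ c ·ₛ Conv V) (embed z) → LatticeSum c z
  integrally-closed ℕ.zero z (p , _ , z≋) =
    (λ ()) , (λ ()) , λ k → sym (ℤtoℚ-injective (trans (z≋ k) (*-zeroˡ (p k))))
  integrally-closed (suc ℕ.zero) z (p , p∈P , z≋) =
    (λ _ → z) , (λ _ → Conv-≋ V (λ k → sym (trans (z≋ k) (*-identityˡ (p k)))) p∈P) , λ k → ℤ.+-identityʳ (z k)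
  integrally-closed (suc (suc c)) z z∈ = prepend s (integrally-closed (suc c) (Split.tail s) (Split.tail∈cP s))
    where s = split c z z∈

-- Part (b)

-- s = e ρ + σ with ρ, σ ∈ [0,1] and a corner ε ∈ {0,1} such that e (ρ - ε) is a multiple of 1/ℓ.
record CoordinateSplit (s e ℓ : ℚ) : Set where
  field
    ε ρ      : ℚ
    steps    : ℤ
    corner   : ε ≡ 0ℚ ⊎ ε ≡ 1ℚ
    0≤ρ      : 0ℚ ≤ ρ
    ρ≤1      : ρ ≤ 1ℚ
    0≤σ      : 0ℚ ≤ s - e * ρ
    σ≤1      : s - e * ρ ≤ 1ℚ
    integral : e * (ρ - ε) * ℓ ≡ ℤtoℚ steps

-- ρ = ⌊s ℓ⌋/(e ℓ) leaves σ = s - ⌊s ℓ⌋/ℓ ∈ [0, 1/ℓ] ⊆ [0, 1].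
rounding-split : ∀ s e ℓ → 1ℚ ≤ s → s < e → 1ℚ ≤ ℓ → CoordinateSplit s e ℓ
rounding-split s e ℓ 1≤s s<e 1≤ℓ = record
  { ε = 0ℚ ; ρ = ρ ; steps = ⌊sℓ⌋ ; corner = inj₁ refl ; 0≤ρ = 0≤* 0≤r (<⇒≤ (0<inv 0<e)) ; ρ≤1 = ρ≤1
  ; 0≤σ = ≤-trans (0≤q-p r≤s) (≤-reflexive (cong (λ t → s - t) (sym eρ≡r)))
  ; σ≤1 = ≤-by-difference (r - (s - 1ℚ)) (0≤q-p s-1≤r)
            (trans (cong (λ t → 1ℚ - (s - t)) eρ≡r) (solve 2 (λ s r → con 1ℚ :- (s :- r) := r :- (s :- con 1ℚ)) refl s r))
  ; integral = integral }
  where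
    0<ℓ : 0ℚ < ℓ
    0<ℓ = <-≤-trans 0<1 1≤ℓ
    ℓ⁻¹ = inv ℓ
    0≤ℓ⁻¹ : 0ℚ ≤ ℓ⁻¹
    0≤ℓ⁻¹ = 0≤inv 0<ℓ
    ℓℓ⁻¹≡1 : ℓ * ℓ⁻¹ ≡ 1ℚ
    ℓℓ⁻¹≡1 = *-inv (pos⇒≢0 0<ℓ)
    ℓ⁻¹≤1 : ℓ⁻¹ ≤ 1ℚ
    ℓ⁻¹≤1 = ≤-trans (≤-reflexive (sym (*-identityʳ ℓ⁻¹)))
              (≤-trans (*-monoˡ-≤-0≤ 0≤ℓ⁻¹ 1≤ℓ) (≤-reflexive (trans (*-comm ℓ⁻¹ ℓ) ℓℓ⁻¹≡1)))
    ⌊sℓ⌋ = floor (s * ℓ)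
    r = ℤtoℚ ⌊sℓ⌋ * ℓ⁻¹
    0<e : 0ℚ < e
    0<e = <-≤-trans 0<1 (≤-trans 1≤s (<⇒≤ s<e))
    ee⁻¹≡1 : e * inv e ≡ 1ℚ
    ee⁻¹≡1 = *-inv (pos⇒≢0 0<e)
    ρ = r * inv e
    eρ≡r : e * ρ ≡ r
    eρ≡r = trans (solve 3 (λ e r E → e :* (r :* E) := r :* (e :* E)) refl e r (inv e)) (trans (cong (r *_) ee⁻¹≡1) (*-identityʳ r))
    sℓℓ⁻¹≡s : s * ℓ * ℓ⁻¹ ≡ s
    sℓℓ⁻¹≡s = trans (solve 3 (λ s l L → s :* l :* L := s :* (l :* L)) refl s ℓ ℓ⁻¹) (trans (cong (s *_) ℓℓ⁻¹≡1) (*-identityʳ s))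
    r≤s : r ≤ s
    r≤s = ≤-trans (*-monoʳ-≤-0≤ 0≤ℓ⁻¹ (proj₁ (floor-bounds (s * ℓ)))) (≤-reflexive sℓℓ⁻¹≡s)
    s-1≤r : s - 1ℚ ≤ r
    s-1≤r = begin
      s - 1ℚ                 ≤⟨ ≤-by-difference (1ℚ - ℓ⁻¹) (0≤q-p ℓ⁻¹≤1)
                                  (solve 2 (λ s L → (s :- L) :- (s :- con 1ℚ) := con 1ℚ :- L) refl s ℓ⁻¹) ⟩
      s - ℓ⁻¹                ≡⟨ sym (trans (solve 3 (λ s l L → (s :* l :- con 1ℚ) :* L := s :* l :* L :- L) refl s ℓ ℓ⁻¹)
                                          (cong (_- ℓ⁻¹) sℓℓ⁻¹≡s)) ⟩
      (s * ℓ - 1ℚ) * ℓ⁻¹     ≤⟨ *-monoʳ-≤-0≤ 0≤ℓ⁻¹ (≤-by-difference {q = ℤtoℚ ⌊sℓ⌋} {p = s * ℓ - 1ℚ} (ℤtoℚ ⌊sℓ⌋ + 1ℚ - s * ℓ)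
                                  (0≤q-p (proj₂ (floor-bounds (s * ℓ))))
                                  (solve 2 (λ n x → n :- (x :- con 1ℚ) := n :+ con 1ℚ :- x) refl (ℤtoℚ ⌊sℓ⌋) (s * ℓ))) ⟩
      ℤtoℚ ⌊sℓ⌋ * ℓ⁻¹        ∎
      where open ≤-Reasoning
    0≤r : 0ℚ ≤ r
    0≤r = ≤-trans (0≤q-p 1≤s) s-1≤r
    ρ≤1 : ρ ≤ 1ℚ
    ρ≤1 = ≤-trans (*-monoʳ-≤-0≤ (<⇒≤ (0<inv 0<e)) (≤-trans r≤s (<⇒≤ s<e))) (≤-reflexive ee⁻¹≡1)
    integral : e * (ρ - 0ℚ) * ℓ ≡ ℤtoℚ ⌊sℓ⌋
    integral = begin
      e * (ρ - 0ℚ) * ℓ       ≡⟨ solve 3 (λ e p l → e :* (p :- con 0ℚ) :* l := (e :* p) :* l) refl e ρ ℓ ⟩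
      e * ρ * ℓ              ≡⟨ cong (_* ℓ) eρ≡r ⟩
      ℤtoℚ ⌊sℓ⌋ * ℓ⁻¹ * ℓ    ≡⟨ solve 3 (λ n L l → n :* L :* l := n :* (l :* L)) refl (ℤtoℚ ⌊sℓ⌋) ℓ⁻¹ ℓ ⟩
      ℤtoℚ ⌊sℓ⌋ * (ℓ * ℓ⁻¹)  ≡⟨ cong (ℤtoℚ ⌊sℓ⌋ *_) ℓℓ⁻¹≡1 ⟩
      ℤtoℚ ⌊sℓ⌋ * 1ℚ         ≡⟨ *-identityʳ (ℤtoℚ ⌊sℓ⌋) ⟩
      ℤtoℚ ⌊sℓ⌋              ∎
      where open ≡-Reasoning

coordinate-split : ∀ s e ℓ → 0ℚ ≤ s → s ≤ e + 1ℚ → 1ℚ ≤ ℓ → CoordinateSplit s e ℓ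
coordinate-split s e ℓ 0≤s s≤e+1 1≤ℓ with e ≤? s
... | yes e≤s = record
  { ε = 1ℚ ; ρ = 1ℚ ; steps = ℤ.+ 0 ; corner = inj₂ refl ; 0≤ρ = <⇒≤ 0<1 ; ρ≤1 = ≤-refl
  ; 0≤σ = ≤-trans (0≤q-p e≤s) (≤-reflexive (cong (λ t → s - t) (sym (*-identityʳ e))))
  ; σ≤1 = ≤-by-difference ((e + 1ℚ) - s) (0≤q-p s≤e+1)
            (solve 2 (λ s e → con 1ℚ :- (s :- e :* con 1ℚ) := (e :+ con 1ℚ) :- s) refl s e)
  ; integral = solve 2 (λ e l → e :* (con 1ℚ :- con 1ℚ) :* l := con 0ℚ) refl e ℓ }
... | no e≰s with s <? 1ℚ
...   | yes s<1 = record
  { ε = 0ℚ ; ρ = 0ℚ ; steps = ℤ.+ 0 ; corner = inj₁ refl ; 0≤ρ = ≤-refl ; ρ≤1 = <⇒≤ 0<1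
  ; 0≤σ = ≤-trans 0≤s (≤-reflexive (solve 2 (λ s e → s := s :- e :* con 0ℚ) refl s e))
  ; σ≤1 = ≤-trans (≤-reflexive (solve 2 (λ s e → s :- e :* con 0ℚ := s) refl s e)) (<⇒≤ s<1)
  ; integral = solve 2 (λ e l → e :* (con 0ℚ :- con 0ℚ) :* l := con 0ℚ) refl e ℓ }
...   | no s≮1 = rounding-split s e ℓ (≮⇒≥ s≮1) (≰⇒> e≰s) 1≤ℓ

-- Only integrality of the direction is used, not its primitivity.
integral-direction : ∀ {d} {v : Point d} → LatLen≥1 v → Σ ℚ λ ℓ → 1ℚ ≤ ℓ × Σ (Fin d → ℤ) λ w → v ≋ (ℓ · embed w)
integral-direction (ℓ , (_ , w , _ , v≋) , 1≤ℓ) = ℓ , 1≤ℓ , w , v≋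

module Parallelepiped {d m : ℕ} (a b : Fin m → Point d) where

  u : Fin m → Point d
  u = λ i → b i ⊖ a i

  base : Point d
  base k = sumℚ (λ i → a i k)

  offset : (Fin m → ℚ) → Point d
  offset t k = sumℚ (λ i → t i * u i k)

  point : (Fin m → ℚ) → Point d
  point t k = sumℚ (λ i → a i k + t i * (b i k - a i k))

  point≡ : ∀ t k → point t k ≡ base k + offset t k
  point≡ t k = sumℚ-+ (λ i → a i k) (λ i → t i * u i k)

  offset-linear : ∀ p q α β k → offset (λ i → p * α i + q * β i) k ≡ p * offset α k + q * offset β k
  offset-linear p q α β k = trans
    (sumℚ-cong (λ i → solve 5 (λ p a q b v → (p :* a :+ q :* b) :* v := p :* (a :* v) :+ q :* (b :* v)) refl p (α i) q (β i) (u i k)))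
    (sumℚ-linear p q (λ i → α i * u i k) (λ i → β i * u i k))

  offset≡ : ∀ {t : Fin m → ℚ} {y : Point d} k → point t k ≡ y k → offset t k ≡ y k - base k
  offset≡ {t} {y} k eq = trans (solve 2 (λ a s → s := (a :+ s) :- a) refl (base k) (offset t k))
                               (cong (_- base k) (trans (sym (point≡ t k)) eq))

  Box = SegSum a b

  point∈Box : ∀ t → (∀ i → 0ℚ ≤ t i × t i ≤ 1ℚ) → Box (point t)
  point∈Box t t∈[0,1] = t , t∈[0,1] , λ k → refl

  Box-convex : Convex Box
  Box-convex {y} {z} α β 0≤α 0≤β α+β≡1 (t , t∈[0,1] , t≡) (t′ , t′∈[0,1] , t′≡) = t″ , t″∈[0,1] , t″≡
    where
      t″ : Fin m → ℚ
      t″ i = α * t i + β * t′ i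
      t″∈[0,1] : ∀ i → 0ℚ ≤ t″ i × t″ i ≤ 1ℚ
      t″∈[0,1] i = +-mono-≤ (0≤* 0≤α (proj₁ (t∈[0,1] i))) (0≤* 0≤β (proj₁ (t′∈[0,1] i)))
                 , ≤-trans (+-mono-≤ (*-monoˡ-≤-0≤ 0≤α (proj₂ (t∈[0,1] i))) (*-monoˡ-≤-0≤ 0≤β (proj₂ (t′∈[0,1] i))))
                           (≤-reflexive (trans (cong₂ _+_ (*-identityʳ α) (*-identityʳ β)) α+β≡1))
      t″≡ : ∀ k → point t″ k ≡ α * y k + β * z k
      t″≡ k = begin
        point t″ k                                          ≡⟨ point≡ t″ k ⟩
        base k + offset t″ k                                ≡⟨ cong (base k +_) (offset-linear α β t t′ k) ⟩
        base k + (α * offset t k + β * offset t′ k)         ≡⟨ cong (_+ (α * offset t k + β * offset t′ k)) (sym (*-identityˡ (base k))) ⟩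
        1ℚ * base k + (α * offset t k + β * offset t′ k)    ≡⟨ cong (λ w → w * base k + (α * offset t k + β * offset t′ k)) (sym α+β≡1) ⟩
        (α + β) * base k + (α * offset t k + β * offset t′ k)
          ≡⟨ solve 5 (λ α β A s s′ → (α :+ β) :* A :+ (α :* s :+ β :* s′) := α :* (A :+ s) :+ β :* (A :+ s′)) refl
               α β (base k) (offset t k) (offset t′ k) ⟩
        α * (base k + offset t k) + β * (base k + offset t′ k) ≡⟨ cong₂ (λ p q → α * p + β * q)
                                                                    (trans (sym (point≡ t k)) (t≡ k)) (trans (sym (point≡ t′ k)) (t′≡ k)) ⟩
        α * y k + β * z k                                   ∎
        where open ≡-Reasoning

  corner-vertex : LinIndep u → ∀ ε → (∀ i → ε i ≡ 0ℚ ⊎ ε i ≡ 1ℚ) → IsVertex Box (point ε)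
  corner-vertex independent ε corner = point∈Box ε ε∈[0,1] , extreme
    where
      ε∈[0,1] : ∀ i → 0ℚ ≤ ε i × ε i ≤ 1ℚ
      ε∈[0,1] i with corner i
      ... | inj₁ εi≡0 = ≤-reflexive (sym εi≡0) , ≤-trans (≤-reflexive εi≡0) (<⇒≤ 0<1)
      ... | inj₂ εi≡1 = ≤-trans (<⇒≤ 0<1) (≤-reflexive (sym εi≡1)) , ≤-reflexive εi≡1
      extreme : ∀ y z τ → Box y → Box z → 0ℚ < τ → τ < 1ℚ → point ε ≋ ((τ · y) ⊕ ((1ℚ - τ) · z)) → y ≋ z
      extreme y z τ (α , α∈[0,1] , α≡) (β , β∈[0,1] , β≡) 0<τ τ<1 ε≡ k =
        trans (sym (α≡ k)) (trans (sumℚ-cong (λ i → cong (λ t → a i k + t * (b i k - a i k)) (α≡β i))) (β≡ k))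
        where
          σ = 1ℚ - τ
          -- τ α + σ β - ε has offset τ (y - base) + σ (z - base) - (τ y + σ z - base) = 0.
          mix≡ε : ∀ i → τ * α i + σ * β i ≡ ε i
          mix≡ε i = trans (solve 2 (λ x e → x := (con 1ℚ :* x :+ (:- con 1ℚ) :* e) :+ e) refl (τ * α i + σ * β i) (ε i))
                          (trans (cong (_+ ε i) (independent (λ i → 1ℚ * (τ * α i + σ * β i) + (- 1ℚ) * ε i) offset≡0 i)) (+-identityˡ (ε i)))
            where
              offset≡0 : ∀ k → offset (λ i → 1ℚ * (τ * α i + σ * β i) + (- 1ℚ) * ε i) k ≡ 0ℚ
              offset≡0 k = begin
                offset (λ i → 1ℚ * (τ * α i + σ * β i) + (- 1ℚ) * ε i) k
                  ≡⟨ offset-linear 1ℚ (- 1ℚ) (λ i → τ * α i + σ * β i) ε k ⟩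
                1ℚ * offset (λ i → τ * α i + σ * β i) k + (- 1ℚ) * offset ε k
                  ≡⟨ cong₂ (λ p q → 1ℚ * p + (- 1ℚ) * q) (offset-linear τ σ α β k) (offset≡ {ε} {(τ · y) ⊕ (σ · z)} k (ε≡ k)) ⟩
                1ℚ * (τ * offset α k + σ * offset β k) + (- 1ℚ) * ((τ * y k + σ * z k) - base k)
                  ≡⟨ cong₂ (λ p q → 1ℚ * (τ * p + σ * q) + (- 1ℚ) * ((τ * y k + σ * z k) - base k)) (offset≡ {α} {y} k (α≡ k)) (offset≡ {β} {z} k (β≡ k)) ⟩
                1ℚ * (τ * (y k - base k) + σ * (z k - base k)) + (- 1ℚ) * ((τ * y k + σ * z k) - base k)
                  ≡⟨ solve 4 (λ t y z a → con 1ℚ :* (t :* (y :- a) :+ (con 1ℚ :- t) :* (z :- a))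
                                          :+ (:- con 1ℚ) :* ((t :* y :+ (con 1ℚ :- t) :* z) :- a) := con 0ℚ) refl τ (y k) (z k) (base k) ⟩
                0ℚ ∎
                where open ≡-Reasoning
          α≡β : ∀ i → α i ≡ β i
          α≡β i with corner i
          ... | inj₁ εi≡0 = let αi≡0 , βi≡0 = convex-combination≡0 0<τ τ<1 (proj₁ (α∈[0,1] i)) (proj₁ (β∈[0,1] i))
                                                (trans (mix≡ε i) εi≡0)
                            in trans αi≡0 (sym βi≡0)
          ... | inj₂ εi≡1 = let αi≡1 , βi≡1 = convex-combination≡1 0<τ τ<1 (proj₂ (α∈[0,1] i)) (proj₂ (β∈[0,1] i))
                                                (trans (mix≡ε i) εi≡1)
                            in trans αi≡1 (sym βi≡1)

  -- Coordinatewise, c tᵢ = (c - 1) ρᵢ + σᵢ with the (c - 1)(ρᵢ - εᵢ) uᵢ integral vectors.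
  dilation⊆union : LinIndep u → (∀ i → LatLen≥1 (u i)) → ∀ c → 1ℚ ≤ c → ∀ y → (c ·ₛ Box) y → UnionSet Box c y
  dilation⊆union independent long c 1≤c y (p , (t , t∈[0,1] , t≡) , y≋) =
      point ε , corner-vertex independent ε corner , (e · point ρ) , (point ρ , point∈Box ρ ρ∈[0,1] , λ _ → refl)
    , difference-integral , (σ , σ∈[0,1] , σ≡)
    where
      e = c - 1ℚ
      0≤c : 0ℚ ≤ c
      0≤c = ≤-trans (<⇒≤ 0<1) 1≤c
      ℓ : Fin m → ℚ
      ℓ i = proj₁ (integral-direction (long i))
      w : Fin m → Fin d → ℤ
      w i = proj₁ (proj₂ (proj₂ (integral-direction (long i))))
      u≡ℓw : ∀ i k → u i k ≡ ℓ i * ℤtoℚ (w i k)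
      u≡ℓw i = proj₂ (proj₂ (proj₂ (integral-direction (long i))))
      split : ∀ i → CoordinateSplit (c * t i) e (ℓ i)
      split i = coordinate-split (c * t i) e (ℓ i) (0≤* 0≤c (proj₁ (t∈[0,1] i)))
        (≤-trans (*-monoˡ-≤-0≤ 0≤c (proj₂ (t∈[0,1] i))) (≤-reflexive (solve 1 (λ c → c :* con 1ℚ := (c :- con 1ℚ) :+ con 1ℚ) refl c)))
        (proj₁ (proj₂ (integral-direction (long i))))
      open module Split i = CoordinateSplit (split i)
      σ : Fin m → ℚ
      σ i = c * t i - e * ρ i
      ρ∈[0,1] : ∀ i → 0ℚ ≤ ρ i × ρ i ≤ 1ℚ
      ρ∈[0,1] i = 0≤ρ i , ρ≤1 i
      σ∈[0,1] : ∀ i → 0ℚ ≤ σ i × σ i ≤ 1ℚ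
      σ∈[0,1] i = 0≤σ i , σ≤1 i
      σ≡ : ∀ k → point σ k ≡ y k - e * point ρ k
      σ≡ k = begin
        point σ k                               ≡⟨ point≡ σ k ⟩
        base k + offset σ k                     ≡⟨ cong (base k +_) (trans (sumℚ-cong (λ i → cong (_* u i k)
                                                     (solve 3 (λ c t r → c :* t :- (c :- con 1ℚ) :* r := c :* t :+ (:- (c :- con 1ℚ)) :* r) refl c (t i) (ρ i))))
                                                     (offset-linear c (- e) t ρ k)) ⟩
        base k + (c * offset t k + (- e) * offset ρ k)
          ≡⟨ solve 4 (λ c a st sr → a :+ (c :* st :+ (:- (c :- con 1ℚ)) :* sr) := c :* (a :+ st) :- (c :- con 1ℚ) :* (a :+ sr)) refl
               c (base k) (offset t k) (offset ρ k) ⟩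
        c * (base k + offset t k) - e * (base k + offset ρ k)
          ≡⟨ cong₂ (λ P Q → c * P - e * Q) (trans (sym (point≡ t k)) (t≡ k)) (sym (point≡ ρ k)) ⟩
        c * p k - e * point ρ k                 ≡⟨ cong (_- e * point ρ k) (sym (y≋ k)) ⟩
        y k - e * point ρ k                     ∎
        where open ≡-Reasoning
      difference-integral : IsIntegral ((e · point ρ) ⊖ (e · point ε))
      difference-integral k = sumℤ (λ i → steps i ℤ.* w i k) , (begin
        e * point ρ k - e * point ε k                     ≡⟨ cong₂ (λ P Q → e * P - e * Q) (point≡ ρ k) (point≡ ε k) ⟩
        e * (base k + offset ρ k) - e * (base k + offset ε k)
          ≡⟨ solve 4 (λ e a r s → e :* (a :+ r) :- e :* (a :+ s) := e :* r :+ (:- e) :* s) refl e (base k) (offset ρ k) (offset ε k) ⟩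
        e * offset ρ k + (- e) * offset ε k               ≡⟨ sym (offset-linear e (- e) ρ ε k) ⟩
        offset (λ i → e * ρ i + (- e) * ε i) k            ≡⟨ sumℚ-cong lattice-step ⟩
        sumℚ (λ i → ℤtoℚ (steps i ℤ.* w i k))             ≡⟨ sym (ℤtoℚ-homo-sumℤ (λ i → steps i ℤ.* w i k)) ⟩
        ℤtoℚ (sumℤ (λ i → steps i ℤ.* w i k))             ∎)
        where
          open ≡-Reasoning
          lattice-step : ∀ i → (e * ρ i + (- e) * ε i) * u i k ≡ ℤtoℚ (steps i ℤ.* w i k)
          lattice-step i = begin
            (e * ρ i + (- e) * ε i) * u i k          ≡⟨ cong ((e * ρ i + (- e) * ε i) *_) (u≡ℓw i k) ⟩
            (e * ρ i + (- e) * ε i) * (ℓ i * ℤtoℚ (w i k))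
              ≡⟨ solve 5 (λ e r x l W → (e :* r :+ (:- e) :* x) :* (l :* W) := e :* (r :- x) :* l :* W) refl e (ρ i) (ε i) (ℓ i) (ℤtoℚ (w i k)) ⟩
            e * (ρ i - ε i) * ℓ i * ℤtoℚ (w i k)     ≡⟨ cong (_* ℤtoℚ (w i k)) (Split.integral i) ⟩
            ℤtoℚ (steps i) * ℤtoℚ (w i k)            ≡⟨ sym (ℤtoℚ-homo-* (steps i) (w i k)) ⟩
            ℤtoℚ (steps i ℤ.* w i k)                 ∎

  decomposition : LinIndep u → (∀ i → LatLen≥1 (u i)) → ∀ c → 1ℚ ≤ c → DecompEq Box c
  decomposition independent long c 1≤c y = dilation⊆union independent long c 1≤c y , union⊆dilation Box-convex c 1≤c y

lemma2p4 : (d : ℕ)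
    → (∀ (n : ℕ) (V : Fin n → Point d) → FullDim (Conv V) → IsLattice (Conv V)
         → ConvexNormal (ℕtoℚ (suc d)) (Conv V) → IntegrallyClosed (Conv V))
    × (∀ (m : ℕ) (a b : Fin m → Point d) → LinIndep (λ i → b i ⊖ a i)
         → FullDim (SegSum a b)
         → (∀ i → LatLen≥1 (b i ⊖ a i))
         → ∀ (c : ℚ) → 1ℚ ≤ c → DecompEq (SegSum a b) c)
    × (∀ (n : ℕ) (V : Fin n → Point d) → FullDim (Conv V)
         → ∀ (c : ℚ) → 1ℚ ≤ c → c * ℕtoℚ d ≤ ℕtoℚ d + 1ℚ → DecompEq (Conv V) c)
lemma2p4 d =
    (λ n V _ lattice normal → IntegralClosure.integrally-closed V lattice normal)
  , (λ m a b independent _ → Parallelepiped.decomposition a b independent)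
  , (λ n V _ → decomposition-small-dilation V)
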